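{- Let $R$ be a complete discrete valuation ring of equal characteristic with maximal ideal $\mathfrak{p}$ and finite residue field $k=R/\mathfrak{p}$ with $|k|>9$, and let $n\ge2$. Then every closed normal subgroup $H\subset\mathrm{SL}_n(R)$ whose image in $\mathrm{SL}_n(k)$ is all of $\mathrm{SL}_n(k)$ is equal to $\mathrm{SL}_n(R)$.
   Context: The topology on $\mathrm{SL}_n(R)$ is the one induced by $R$. -}

module Defs where

open import Level using (Level; _⊔_)
open import Algebra.Bundles using (CommutativeRing)
open import Data.Nat as ℕ using (ℕ; zero; suc)
open import Data.Nat.Primality using (Prime)
open import Data.Fin using (Fin; zero; suc; punchIn)
open import Data.Product using (Σ; ∃; _×_; _,_)
open import Data.Sum using (_⊎_)
open import Relation.Nullary using (¬_)
open import Relation.Binary.PropositionalEquality using (_≡_)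

module _ {c ℓ : Level} (R : CommutativeRing c ℓ) where
  open CommutativeRing R using (Carrier; _≈_; _+_; _*_; -_; _-_; 0#; 1#)

  _∣_ : Carrier → Carrier → Set (c ⊔ ℓ)
  a ∣ b = Σ Carrier λ k → k * a ≈ b

  _^_ : Carrier → ℕ → Carrier
  x ^ zero  = 1#
  x ^ suc m = x * (x ^ m)

  natCast : ℕ → Carrier
  natCast zero    = 0#
  natCast (suc m) = 1# + natCast m

  IsUnit : Carrier → Set (c ⊔ ℓ)
  IsUnit u = Σ Carrier λ v → u * v ≈ 1#

  -- R is a discrete valuation ring with uniformizer π:
  -- an integral domain in which π is a non-unit and every nonzero
  -- element is a unit times a power of π.  Its maximal ideal is 𝔭 = (π).
  record IsDVR (π : Carrier) : Set (c ⊔ ℓ) where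
    field
      1≉0        : ¬ (1# ≈ 0#)
      noZeroDiv  : ∀ a b → a * b ≈ 0# → (a ≈ 0#) ⊎ (b ≈ 0#)
      π-nonunit  : ¬ IsUnit π
      valuation  : ∀ x → ¬ (x ≈ 0#) → Σ Carrier λ u → Σ ℕ λ m → IsUnit u × (x ≈ u * (π ^ m))

  _≡[_]_ : Carrier → Carrier → ℕ → Carrier → Set (c ⊔ ℓ)
  (a ≡[ π ] m) b = (π ^ m) ∣ (a - b)

  IsComplete : Carrier → Set (c ⊔ ℓ)
  IsComplete π = (a : ℕ → Carrier) →
    (∀ m → Σ ℕ λ N → ∀ i j → N ℕ.≤ i → N ℕ.≤ j → (a i ≡[ π ] m) (a j)) →
    Σ Carrier λ L → ∀ m → Σ ℕ λ N → ∀ i → N ℕ.≤ i → (a i ≡[ π ] m) L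

  -- equal characteristic (residue field finite of char p, so char R = p)
  EqualChar : Set ℓ
  EqualChar = Σ ℕ λ p → Prime p × (natCast p ≈ 0#)

  -- the residue field k = R/𝔭 is finite with q elements:
  -- representatives r : Fin q → R, pairwise distinct mod 𝔭 and covering R mod 𝔭
  ResidueFieldCard : Carrier → ℕ → Set (c ⊔ ℓ)
  ResidueFieldCard π q = Σ (Fin q → Carrier) λ r →
      (∀ i j → (r i ≡[ π ] 1) (r j) → i ≡ j)
    × (∀ x → Σ (Fin q) λ i → (x ≡[ π ] 1) (r i))

  Mat : ℕ → Set c
  Mat n = Fin n → Fin n → Carrier

  sumF : ∀ {n} → (Fin n → Carrier) → Carrier
  sumF {zero}  f = 0#
  sumF {suc n} f = f zero + sumF (λ i → f (suc i))

  _·_ : ∀ {n} → Mat n → Mat n → Mat n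
  (A · B) i j = sumF λ k → A i k * B k j

  idM : ∀ {n} → Mat n
  idM {suc n} zero    zero    = 1#
  idM {suc n} zero    (suc j) = 0#
  idM {suc n} (suc i) zero    = 0#
  idM {suc n} (suc i) (suc j) = idM {n} i j

  _≈M_ : ∀ {n} → Mat n → Mat n → Set ℓ
  A ≈M B = ∀ i j → A i j ≈ B i j

  sign : ℕ → Carrier
  sign zero    = 1#
  sign (suc m) = - sign m

  minor : ∀ {n} → Mat (suc n) → Fin (suc n) → Mat n
  minor A j r s = A (suc r) (punchIn j s)

  det : ∀ {n} → Mat n → Carrier
  det {zero}  A = 1#
  det {suc n} A = sumF λ j → sign (Data.Fin.toℕ j) * (A zero j * det (minor A j))

  InSL : ∀ {n} → Mat n → Set ℓ
  InSL A = det A ≈ 1#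

  _≡M[_]_ : ∀ {n} → Mat n → Carrier → ℕ → Mat n → Set (c ⊔ ℓ)
  (A ≡M[ π ] m) B = ∀ i j → (A i j ≡[ π ] m) (B i j)

  record IsSubgroupSL {ℓ'} (n : ℕ) (H : Mat n → Set ℓ') : Set (c ⊔ ℓ ⊔ ℓ') where
    field
      resp   : ∀ A B → A ≈M B → H A → H B
      inSL   : ∀ A → H A → InSL A
      hasId  : H idM
      mulCl  : ∀ A B → H A → H B → H (A · B)
      invCl  : ∀ A B → H A → (A · B) ≈M idM → H B

  IsNormalSL : ∀ {ℓ'} (n : ℕ) (H : Mat n → Set ℓ') → Set (c ⊔ ℓ ⊔ ℓ')
  IsNormalSL n H = ∀ g g' h → InSL g → (g · g') ≈M idM → H h → H ((g · h) · g')

  IsClosed : ∀ {ℓ'} (n : ℕ) → Carrier → (Mat n → Set ℓ') → Set (c ⊔ ℓ ⊔ ℓ')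
  IsClosed n π H = ∀ A → (∀ m → Σ (Mat n) λ B → H B × (A ≡M[ π ] m) B) → H A

  -- image of H in SL_n(k) is all of SL_n(k): every matrix over R whose
  -- reduction lies in SL_n(k) (det ≡ 1 mod 𝔭) is congruent mod 𝔭 to an element of H
  SurjectsResidue : ∀ {ℓ'} (n : ℕ) → Carrier → (Mat n → Set ℓ') → Set (c ⊔ ℓ ⊔ ℓ')
  SurjectsResidue n π H = ∀ A → (det A ≡[ π ] 1) 1# → Σ (Mat n) λ B → H B × (A ≡M[ π ] 1) B

module Submission where

-- Since H is closed, it suffices to show that every A ∈ SL_n(R) is congruent
-- modulo every power 𝔭^K to an element of H.  We build these approximations
-- layer by layer.  Surjectivity gives a first approximation mod 𝔭; the
-- correction B = A·h⁻¹ then lies in the congruence subgroup Γ(1).  For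
-- B ≡ I + π^M X (mod π^(M+1)) with det B = 1 one has tr X ≡ 0 (mod π), and
-- every such X is a sum of multiples of the elementary matrices E_ij (i ≠ j)
-- and of E_jj - E_ii, up to a multiple of π.  Each of these "infinitesimal
-- generators" is realised inside H, modulo π^(M+1), by a commutator
-- [h, I + π^M b E_ij] with h ∈ H lifting a suitable matrix W ∈ SL_n(R):
-- for E_ij take W diagonal with entries u, u⁻¹ where u and u² - 1 are units
-- (this needs |k| ≥ 4), for E_jj - E_ii take W = I + E_ji.  Normality puts
-- the commutator in H.  Multiplying these lifts peels off one layer at a
-- time.

open import Defs
open import Level using (Level; _⊔_)
open import Algebra.Bundles using (CommutativeRing; Ring)
open import Data.Nat as ℕ using (ℕ; zero; suc; _≤_)
import Data.Nat.Properties as ℕP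
open import Data.Integer as ℤ using (ℤ; +_; -[1+_])
import Data.Integer.Properties as ℤP
import Data.Sign as Sign
open import Data.Fin as F using (Fin; zero; suc; punchIn)
import Data.Fin.Properties as FP
open import Data.Product using (Σ; _×_; _,_; proj₁; proj₂)
open import Data.Sum using (_⊎_; inj₁; inj₂)
open import Data.Maybe using (Maybe; just; nothing)
open import Data.List using (List; []; _∷_; _++_)
open import Data.Empty using (⊥-elim)
open import Relation.Nullary using (¬_; Dec; yes; no)
open import Relation.Binary.Definitions using (tri<; tri≈; tri>)
import Relation.Binary.PropositionalEquality as P
import Algebra.Solver.Ring.AlmostCommutativeRing as ACR
import Algebra.Properties.RingWithoutOne as RingWithoutOneProperties
import Algebra.Properties.AbelianGroup as AbelianGroupProperties
import Algebra.Properties.Group as GroupProperties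
import Algebra.Properties.Semiring.Mult.TCOptimised as SemiringMult

-- The ring solver of the standard library, instantiated for an arbitrary
-- commutative ring with integer coefficients through the canonical ring
-- homomorphism ℤ → R.
module IntegerSolver {c ℓ : Level} (R : CommutativeRing c ℓ) where
  open CommutativeRing R hiding (zero)
  open import Relation.Binary.Reasoning.Setoid setoid
  open RingWithoutOneProperties (Ring.ringWithoutOne ring) using (-‿distribˡ-*)
  open AbelianGroupProperties +-abelianGroup using (⁻¹-∙-comm)
  open GroupProperties +-group using (⁻¹-involutive)
  open SemiringMult semiring using (×-homo-+; ×1-homo-*; 1+×) renaming (_×_ to _×ᴿ_)

  -- the image of a natural number: n ↦ 1 + ... + 1 (with 1 ↦ 1# on the
  -- nose, so that the solver's constant 1 is literally 1#)
  fromℕ : ℕ → Carrier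
  fromℕ n = n ×ᴿ 1#

  fromSign : Sign.Sign → Carrier
  fromSign Sign.+ = 1#
  fromSign Sign.- = - 1#

  fromℤ : ℤ → Carrier
  fromℤ (+ n)    = fromℕ n
  fromℤ -[1+ n ] = - fromℕ (suc n)

  -0≈0 : - 0# ≈ 0#
  -0≈0 = trans (sym (+-identityˡ (- 0#))) (-‿inverseʳ 0#)

  -1*x≈-x : ∀ x → - 1# * x ≈ - x
  -1*x≈-x x = trans (sym (-‿distribˡ-* 1# x)) (-‿cong (*-identityˡ x))

  fromℤ-signAbs : ∀ i → fromℤ i ≈ fromSign (ℤ.sign i) * fromℕ ℤ.∣ i ∣
  fromℤ-signAbs (+ zero)  = sym (zeroʳ _)
  fromℤ-signAbs (+ suc n) = sym (*-identityˡ _)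
  fromℤ-signAbs -[1+ n ]  = sym (-1*x≈-x _)

  fromℤ-◃ : ∀ s n → fromℤ (s ℤ.◃ n) ≈ fromSign s * fromℕ n
  fromℤ-◃ s      zero    = sym (zeroʳ _)
  fromℤ-◃ Sign.+ (suc n) = sym (*-identityˡ _)
  fromℤ-◃ Sign.- (suc n) = sym (-1*x≈-x _)

  fromSign-* : ∀ s t → fromSign (s Sign.* t) ≈ fromSign s * fromSign t
  fromSign-* Sign.+ t      = sym (*-identityˡ _)
  fromSign-* Sign.- Sign.+ = sym (*-identityʳ _)
  fromSign-* Sign.- Sign.- = trans (sym (⁻¹-involutive 1#)) (sym (-1*x≈-x _))

  interchange-* : ∀ a b x y → (a * b) * (x * y) ≈ (a * x) * (b * y)
  interchange-* a b x y = begin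
    (a * b) * (x * y)   ≈⟨ *-assoc a b (x * y) ⟩
    a * (b * (x * y))   ≈⟨ *-congˡ (sym (*-assoc b x y)) ⟩
    a * ((b * x) * y)   ≈⟨ *-congˡ (*-congʳ (*-comm b x)) ⟩
    a * ((x * b) * y)   ≈⟨ *-congˡ (*-assoc x b y) ⟩
    a * (x * (b * y))   ≈⟨ sym (*-assoc a x (b * y)) ⟩
    (a * x) * (b * y)   ∎

  interchange-+ : ∀ a b x y → (a + b) + (x + y) ≈ (a + x) + (b + y)
  interchange-+ a b x y = begin
    (a + b) + (x + y)   ≈⟨ +-assoc a b (x + y) ⟩
    a + (b + (x + y))   ≈⟨ +-congˡ (sym (+-assoc b x y)) ⟩
    a + ((b + x) + y)   ≈⟨ +-congˡ (+-congʳ (+-comm b x)) ⟩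
    a + ((x + b) + y)   ≈⟨ +-congˡ (+-assoc x b y) ⟩
    a + (x + (b + y))   ≈⟨ sym (+-assoc a x (b + y)) ⟩
    (a + x) + (b + y)   ∎

  fromℤ-⊖ : ∀ m n → fromℤ (m ℤ.⊖ n) ≈ fromℕ m - fromℕ n
  fromℤ-⊖ m       zero    = sym (trans (+-congˡ -0≈0) (+-identityʳ _))
  fromℤ-⊖ zero    (suc n) = sym (+-identityˡ _)
  fromℤ-⊖ (suc m) (suc n) = begin
    fromℤ (suc m ℤ.⊖ suc n)          ≡⟨ P.cong fromℤ (ℤP.[1+m]⊖[1+n]≡m⊖n m n) ⟩
    fromℤ (m ℤ.⊖ n)                  ≈⟨ fromℤ-⊖ m n ⟩
    fromℕ m - fromℕ n                ≈⟨ sym (+-identityˡ _) ⟩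
    0# + (fromℕ m - fromℕ n)         ≈⟨ +-congʳ (sym (-‿inverseʳ 1#)) ⟩
    (1# - 1#) + (fromℕ m - fromℕ n)  ≈⟨ interchange-+ 1# (- 1#) (fromℕ m) (- fromℕ n) ⟩
    (1# + fromℕ m) + (- 1# - fromℕ n) ≈⟨ +-congˡ (⁻¹-∙-comm 1# (fromℕ n)) ⟩
    (1# + fromℕ m) - (1# + fromℕ n)  ≈⟨ sym (+-cong (1+× m 1#) (-‿cong (1+× n 1#))) ⟩
    fromℕ (suc m) - fromℕ (suc n)    ∎

  fromℤ-+ : ∀ i j → fromℤ (i ℤ.+ j) ≈ fromℤ i + fromℤ j
  fromℤ-+ (+ m)    (+ n)    = ×-homo-+ 1# m n
  fromℤ-+ (+ m)    -[1+ n ] = fromℤ-⊖ m (suc n)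
  fromℤ-+ -[1+ m ] (+ n)    = trans (fromℤ-⊖ n (suc m)) (+-comm _ _)
  fromℤ-+ -[1+ m ] -[1+ n ] = begin
    - fromℕ (suc (suc (m ℕ.+ n)))       ≡⟨ P.cong (λ k → - fromℕ (suc k)) (P.sym (ℕP.+-suc m n)) ⟩
    - fromℕ (suc m ℕ.+ suc n)           ≈⟨ -‿cong (×-homo-+ 1# (suc m) (suc n)) ⟩
    - (fromℕ (suc m) + fromℕ (suc n))   ≈⟨ sym (⁻¹-∙-comm _ _) ⟩
    - fromℕ (suc m) + - fromℕ (suc n)   ∎

  fromℤ-* : ∀ i j → fromℤ (i ℤ.* j) ≈ fromℤ i * fromℤ j
  fromℤ-* i j = begin
    fromℤ (ℤ.sign i Sign.* ℤ.sign j ℤ.◃ ℤ.∣ i ∣ ℕ.* ℤ.∣ j ∣)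
      ≈⟨ fromℤ-◃ (ℤ.sign i Sign.* ℤ.sign j) (ℤ.∣ i ∣ ℕ.* ℤ.∣ j ∣) ⟩
    fromSign (ℤ.sign i Sign.* ℤ.sign j) * fromℕ (ℤ.∣ i ∣ ℕ.* ℤ.∣ j ∣)
      ≈⟨ *-cong (fromSign-* (ℤ.sign i) (ℤ.sign j)) (×1-homo-* ℤ.∣ i ∣ ℤ.∣ j ∣) ⟩
    (fromSign (ℤ.sign i) * fromSign (ℤ.sign j)) * (fromℕ ℤ.∣ i ∣ * fromℕ ℤ.∣ j ∣)
      ≈⟨ interchange-* _ _ _ _ ⟩
    (fromSign (ℤ.sign i) * fromℕ ℤ.∣ i ∣) * (fromSign (ℤ.sign j) * fromℕ ℤ.∣ j ∣)
      ≈⟨ sym (*-cong (fromℤ-signAbs i) (fromℤ-signAbs j)) ⟩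
    fromℤ i * fromℤ j ∎

  fromℤ-neg : ∀ i → fromℤ (ℤ.- i) ≈ - fromℤ i
  fromℤ-neg (+ zero)  = sym -0≈0
  fromℤ-neg (+ suc n) = refl
  fromℤ-neg -[1+ n ]  = sym (⁻¹-involutive _)

  almostCommutativeRing : ACR.AlmostCommutativeRing c ℓ
  almostCommutativeRing = ACR.fromCommutativeRing R

  fromℤ-morphism : ℤ.+-*-rawRing ACR.-Raw-AlmostCommutative⟶ almostCommutativeRing
  fromℤ-morphism = record
    { ⟦_⟧ = fromℤ ; +-homo = fromℤ-+ ; *-homo = fromℤ-* ; -‿homo = fromℤ-neg
    ; 0-homo = refl ; 1-homo = refl }

  coefficient-equality : ∀ i j → Maybe (fromℤ i ≈ fromℤ j)
  coefficient-equality i j with i ℤ.≟ j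
  ... | yes i≡j = just (reflexive (P.cong fromℤ i≡j))
  ... | no _    = nothing

  open import Algebra.Solver.Ring ℤ.+-*-rawRing almostCommutativeRing fromℤ-morphism coefficient-equality public

  K1 K0 : ∀ {m} → Polynomial m
  K1 = con (+ 1)
  K0 = con (+ 0)

module MatrixAlgebra {c ℓ : Level} (R : CommutativeRing c ℓ) where
  open CommutativeRing R hiding (zero)
  open import Relation.Binary.Reasoning.Setoid setoid
  open AbelianGroupProperties +-abelianGroup using (⁻¹-∙-comm)
  open IntegerSolver R

  ∑ : ∀ {n} → (Fin n → Carrier) → Carrier
  ∑ = sumF R

  ∑-cong : ∀ {n} {f g : Fin n → Carrier} → (∀ i → f i ≈ g i) → ∑ f ≈ ∑ g
  ∑-cong {zero}  f≈g = refl
  ∑-cong {suc n} f≈g = +-cong (f≈g zero) (∑-cong (λ i → f≈g (suc i)))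

  ∑-+ : ∀ {n} (f g : Fin n → Carrier) → ∑ (λ i → f i + g i) ≈ ∑ f + ∑ g
  ∑-+ {zero}  f g = sym (+-identityʳ 0#)
  ∑-+ {suc n} f g = trans (+-congˡ (∑-+ (λ i → f (suc i)) (λ i → g (suc i))))
    (interchange-+ _ _ _ _)

  ∑-*ˡ : ∀ {n} (a : Carrier) (f : Fin n → Carrier) → a * ∑ f ≈ ∑ (λ i → a * f i)
  ∑-*ˡ {zero}  a f = zeroʳ a
  ∑-*ˡ {suc n} a f = trans (distribˡ _ _ _) (+-congˡ (∑-*ˡ a (λ i → f (suc i))))

  ∑-*ʳ : ∀ {n} (a : Carrier) (f : Fin n → Carrier) → ∑ f * a ≈ ∑ (λ i → f i * a)
  ∑-*ʳ a f = trans (*-comm _ _) (trans (∑-*ˡ a f) (∑-cong (λ i → *-comm a (f i))))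

  ∑-zero : ∀ {n} (f : Fin n → Carrier) → (∀ i → f i ≈ 0#) → ∑ f ≈ 0#
  ∑-zero {zero}  f f≈0 = refl
  ∑-zero {suc n} f f≈0 = trans (+-cong (f≈0 zero) (∑-zero _ (λ i → f≈0 (suc i)))) (+-identityˡ 0#)

  ∑-neg : ∀ {n} (f : Fin n → Carrier) → ∑ (λ i → - f i) ≈ - ∑ f
  ∑-neg {zero}  f = sym -0≈0
  ∑-neg {suc n} f = trans (+-congˡ (∑-neg (λ i → f (suc i)))) (⁻¹-∙-comm _ _)

  ∑-swap : ∀ {m n} (f : Fin m → Fin n → Carrier) →
    ∑ (λ i → ∑ (λ j → f i j)) ≈ ∑ (λ j → ∑ (λ i → f i j))
  ∑-swap {zero}  {n} f = sym (∑-zero {n} _ (λ j → refl))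
  ∑-swap {suc m} {n} f = begin
    ∑ (λ j → f zero j) + ∑ (λ i → ∑ (λ j → f (suc i) j))
      ≈⟨ +-congˡ (∑-swap (λ i j → f (suc i) j)) ⟩
    ∑ (λ j → f zero j) + ∑ (λ j → ∑ (λ i → f (suc i) j))
      ≈⟨ sym (∑-+ {n} (λ j → f zero j) (λ j → ∑ (λ i → f (suc i) j))) ⟩
    ∑ (λ j → f zero j + ∑ (λ i → f (suc i) j)) ∎

  ∑-single : ∀ {n} (f : Fin n → Carrier) (k : Fin n) → (∀ i → ¬ i P.≡ k → f i ≈ 0#) → ∑ f ≈ f k
  ∑-single {suc n} f zero    f≈0 = trans (+-congˡ (∑-zero _ (λ i → f≈0 (suc i) (λ ())))) (+-identityʳ _)
  ∑-single {suc n} f (suc k) f≈0 = trans (+-congʳ (f≈0 zero (λ ()))) (trans (+-identityˡ _)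
    (∑-single (λ i → f (suc i)) k (λ i i≢k → f≈0 (suc i) (λ eq → i≢k (FP.suc-injective eq)))))

  ∏ : ∀ {n} → (Fin n → Carrier) → Carrier
  ∏ {zero}  f = 1#
  ∏ {suc n} f = f zero * ∏ (λ i → f (suc i))

  ∏-cong : ∀ {n} {f g : Fin n → Carrier} → (∀ i → f i ≈ g i) → ∏ f ≈ ∏ g
  ∏-cong {zero}  f≈g = refl
  ∏-cong {suc n} f≈g = *-cong (f≈g zero) (∏-cong (λ i → f≈g (suc i)))

  ∏-* : ∀ {n} (f g : Fin n → Carrier) → ∏ (λ i → f i * g i) ≈ ∏ f * ∏ g
  ∏-* {zero}  f g = sym (*-identityʳ 1#)
  ∏-* {suc n} f g = trans (*-congˡ (∏-* (λ i → f (suc i)) (λ i → g (suc i)))) (interchange-* _ _ _ _)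

  ∏-one : ∀ n → ∏ {n} (λ _ → 1#) ≈ 1#
  ∏-one zero    = refl
  ∏-one (suc n) = trans (*-identityˡ _) (∏-one n)

  ∏-single : ∀ {n} (f : Fin n → Carrier) (k : Fin n) → (∀ i → ¬ i P.≡ k → f i ≈ 1#) → ∏ f ≈ f k
  ∏-single {suc n} f zero    f≈1 =
    trans (*-congˡ (trans (∏-cong {n} (λ i → f≈1 (suc i) (λ ()))) (∏-one n))) (*-identityʳ _)
  ∏-single {suc n} f (suc k) f≈1 = trans (*-congʳ (f≈1 zero (λ ()))) (trans (*-identityˡ _)
    (∏-single (λ i → f (suc i)) k (λ i i≢k → f≈1 (suc i) (λ eq → i≢k (FP.suc-injective eq)))))

  pick : ∀ {p} {Q : Set p} → Dec Q → Carrier → Carrier → Carrier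
  pick (yes _) a b = a
  pick (no _)  a b = b

  pick-yes : ∀ {p} {Q : Set p} (d : Dec Q) (a b : Carrier) → Q → pick d a b ≈ a
  pick-yes (yes _)  a b q = refl
  pick-yes (no ¬q)  a b q = ⊥-elim (¬q q)

  pick-no : ∀ {p} {Q : Set p} (d : Dec Q) (a b : Carrier) → ¬ Q → pick d a b ≈ b
  pick-no (yes q) a b ¬q = ⊥-elim (¬q q)
  pick-no (no _)  a b ¬q = refl

  Matrix : ℕ → Set c
  Matrix = Mat R

  infixl 7 _⊙_ _⋆_
  infixl 6 _⊕_
  infix 4 _≋_

  _⊙_ : ∀ {n} → Matrix n → Matrix n → Matrix n
  _⊙_ = _·_ R

  I : ∀ {n} → Matrix n
  I = idM R

  _≋_ : ∀ {n} → Matrix n → Matrix n → Set ℓ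
  _≋_ = _≈M_ R

  _⊕_ : ∀ {n} → Matrix n → Matrix n → Matrix n
  (A ⊕ B) i j = A i j + B i j

  _⋆_ : ∀ {n} → Carrier → Matrix n → Matrix n
  (a ⋆ B) i j = a * B i j

  ⊝ : ∀ {n} → Matrix n → Matrix n
  ⊝ A i j = - A i j

  O : ∀ {n} → Matrix n
  O i j = 0#

  E : ∀ {n} → Fin n → Fin n → Matrix n
  E i j r s = I r i * I j s

  tr : ∀ {n} → Matrix n → Carrier
  tr A = ∑ (λ i → A i i)

  ≋-refl : ∀ {n} {A : Matrix n} → A ≋ A
  ≋-refl i j = refl

  ≋-sym : ∀ {n} {A B : Matrix n} → A ≋ B → B ≋ A
  ≋-sym A≋B i j = sym (A≋B i j)

  ≋-trans : ∀ {n} {A B C : Matrix n} → A ≋ B → B ≋ C → A ≋ C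
  ≋-trans A≋B B≋C i j = trans (A≋B i j) (B≋C i j)

  ⊕-cong : ∀ {n} {A A' B B' : Matrix n} → A ≋ A' → B ≋ B' → A ⊕ B ≋ A' ⊕ B'
  ⊕-cong A≋A' B≋B' i j = +-cong (A≋A' i j) (B≋B' i j)

  ⋆-cong : ∀ {n} a {A B : Matrix n} → A ≋ B → a ⋆ A ≋ a ⋆ B
  ⋆-cong a A≋B i j = *-congˡ (A≋B i j)

  I-diag : ∀ {n} (i : Fin n) → I i i ≈ 1#
  I-diag {suc n} zero    = refl
  I-diag {suc n} (suc i) = I-diag i

  I-off : ∀ {n} (i j : Fin n) → ¬ i P.≡ j → I i j ≈ 0#
  I-off {suc n} zero    zero    i≢j = ⊥-elim (i≢j P.refl)
  I-off {suc n} zero    (suc j) i≢j = refl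
  I-off {suc n} (suc i) zero    i≢j = refl
  I-off {suc n} (suc i) (suc j) i≢j = I-off i j (λ eq → i≢j (P.cong suc eq))

  I-symmetric : ∀ {n} (i j : Fin n) → I i j ≈ I j i
  I-symmetric i j with i F.≟ j
  ... | yes P.refl = refl
  ... | no i≢j     = trans (I-off i j i≢j) (sym (I-off j i (λ eq → i≢j (P.sym eq))))

  ⊙-cong : ∀ {n} {A A' B B' : Matrix n} → A ≋ A' → B ≋ B' → A ⊙ B ≋ A' ⊙ B'
  ⊙-cong {n} A≋A' B≋B' i j = ∑-cong {n} (λ k → *-cong (A≋A' i k) (B≋B' k j))

  ⊙-assoc : ∀ {n} (A B C : Matrix n) → (A ⊙ B) ⊙ C ≋ A ⊙ (B ⊙ C)
  ⊙-assoc {n} A B C i j = begin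
    ∑ (λ k → ∑ (λ p → A i p * B p k) * C k j)
      ≈⟨ ∑-cong {n} (λ k → ∑-*ʳ {n} (C k j) (λ p → A i p * B p k)) ⟩
    ∑ (λ k → ∑ (λ p → A i p * B p k * C k j))
      ≈⟨ ∑-swap {n} {n} (λ k p → A i p * B p k * C k j) ⟩
    ∑ (λ p → ∑ (λ k → A i p * B p k * C k j))
      ≈⟨ ∑-cong {n} (λ p → ∑-cong {n} (λ k → *-assoc _ _ _)) ⟩
    ∑ (λ p → ∑ (λ k → A i p * (B p k * C k j)))
      ≈⟨ ∑-cong {n} (λ p → sym (∑-*ˡ {n} (A i p) (λ k → B p k * C k j))) ⟩
    ∑ (λ p → A i p * ∑ (λ k → B p k * C k j)) ∎

  I-⊙ : ∀ {n} (A : Matrix n) → I ⊙ A ≋ A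
  I-⊙ {n} A i j = trans (∑-single {n} (λ k → I i k * A k j) i
      (λ k k≢i → trans (*-congʳ (I-off i k (λ eq → k≢i (P.sym eq)))) (zeroˡ _)))
    (trans (*-congʳ (I-diag i)) (*-identityˡ _))

  ⊙-I : ∀ {n} (A : Matrix n) → A ⊙ I ≋ A
  ⊙-I {n} A i j = trans (∑-single {n} (λ k → A i k * I k j) j
      (λ k k≢j → trans (*-congˡ (I-off k j k≢j)) (zeroʳ _)))
    (trans (*-congˡ (I-diag j)) (*-identityʳ _))

  ⊙-⊕ʳ : ∀ {n} (A B C : Matrix n) → A ⊙ (B ⊕ C) ≋ A ⊙ B ⊕ A ⊙ C
  ⊙-⊕ʳ {n} A B C i j = trans (∑-cong {n} (λ k → distribˡ _ _ _)) (∑-+ {n} _ _)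

  ⊙-⊕ˡ : ∀ {n} (A B C : Matrix n) → (A ⊕ B) ⊙ C ≋ A ⊙ C ⊕ B ⊙ C
  ⊙-⊕ˡ {n} A B C i j = trans (∑-cong {n} (λ k → distribʳ _ _ _)) (∑-+ {n} _ _)

  ⊙-⋆ʳ : ∀ {n} (a : Carrier) (A B : Matrix n) → A ⊙ (a ⋆ B) ≋ a ⋆ (A ⊙ B)
  ⊙-⋆ʳ {n} a A B i j = trans
    (∑-cong {n} (λ k → solve 3 (λ x y z → x :* (y :* z) := y :* (x :* z)) refl _ _ _))
    (sym (∑-*ˡ {n} a _))

  ⊙-⋆ˡ : ∀ {n} (a : Carrier) (A B : Matrix n) → (a ⋆ A) ⊙ B ≋ a ⋆ (A ⊙ B)
  ⊙-⋆ˡ {n} a A B i j = trans (∑-cong {n} (λ k → *-assoc _ _ _)) (sym (∑-*ˡ {n} a _))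

  ⊙-E-⊙ : ∀ {n} (A B : Matrix n) i j b r s → (A ⊙ ((b ⋆ E i j) ⊙ B)) r s ≈ A r i * b * B j s
  ⊙-E-⊙ {n} A B i j b r s = begin
    ∑ (λ p → A r p * ∑ (λ k → b * (I p i * I j k) * B k s))
      ≈⟨ ∑-cong {n} (λ p → *-congˡ (inner p)) ⟩
    ∑ (λ p → A r p * ((b * I p i) * B j s))
      ≈⟨ ∑-cong {n} (λ p → solve 4 (λ a b x y → a :* ((b :* x) :* y) := (a :* x) :* (b :* y)) refl (A r p) b (I p i) (B j s)) ⟩
    ∑ (λ p → (A r p * I p i) * (b * B j s))
      ≈⟨ sym (∑-*ʳ {n} (b * B j s) (λ p → A r p * I p i)) ⟩
    ∑ (λ p → A r p * I p i) * (b * B j s)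
      ≈⟨ *-congʳ (⊙-I A r i) ⟩
    A r i * (b * B j s)  ≈⟨ sym (*-assoc _ _ _) ⟩
    A r i * b * B j s   ∎
    where
    inner : ∀ p → ∑ (λ k → b * (I p i * I j k) * B k s) ≈ (b * I p i) * B j s
    inner p = begin
      ∑ (λ k → b * (I p i * I j k) * B k s)
        ≈⟨ ∑-cong {n} (λ k → solve 4 (λ b x y z → b :* (x :* y) :* z := (b :* x) :* (y :* z)) refl b (I p i) (I j k) (B k s)) ⟩
      ∑ (λ k → (b * I p i) * (I j k * B k s)) ≈⟨ sym (∑-*ˡ {n} (b * I p i) (λ k → I j k * B k s)) ⟩
      (b * I p i) * ∑ (λ k → I j k * B k s)   ≈⟨ *-congˡ (I-⊙ B j s) ⟩
      (b * I p i) * B j s ∎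

  diagonal : ∀ {n} → (Fin n → Carrier) → Matrix n
  diagonal d r s = I r s * d r

  diagonal-inverse : ∀ {n} (d d' : Fin n → Carrier) → (∀ r → d' r * d r ≈ 1#) → diagonal d' ⊙ diagonal d ≋ I
  diagonal-inverse {n} d d' d'd≈1 r s = begin
    ∑ (λ k → (I r k * d' r) * (I k s * d k))
      ≈⟨ ∑-single {n} (λ k → (I r k * d' r) * (I k s * d k)) r
           (λ k k≢r → trans (*-congʳ (trans (*-congʳ (I-off r k (λ eq → k≢r (P.sym eq)))) (zeroˡ _))) (zeroˡ _)) ⟩
    (I r r * d' r) * (I r s * d r)  ≈⟨ *-congʳ (*-congʳ (I-diag r)) ⟩
    (1# * d' r) * (I r s * d r)     ≈⟨ solve 3 (λ x y z → (K1 :* x) :* (y :* z) := y :* (x :* z)) refl (d' r) (I r s) (d r) ⟩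
    I r s * (d' r * d r)            ≈⟨ trans (*-congˡ (d'd≈1 r)) (*-identityʳ _) ⟩
    I r s ∎

  scaleAt : ∀ {n} → Fin n → Carrier → Fin n → Carrier
  scaleAt i u r = pick (r F.≟ i) u 1#

  scaleAt-at : ∀ {n} (i : Fin n) u → scaleAt i u i ≈ u
  scaleAt-at i u = pick-yes (i F.≟ i) u 1# P.refl

  scaleAt-off : ∀ {n} (i : Fin n) u r → ¬ r P.≡ i → scaleAt i u r ≈ 1#
  scaleAt-off i u r = pick-no (r F.≟ i) u 1#

  scaleAt-inverse : ∀ {n} (i : Fin n) {u v} → v * u ≈ 1# → ∀ r → scaleAt i v r * scaleAt i u r ≈ 1#
  scaleAt-inverse i vu≈1 r with r F.≟ i
  ... | yes _ = vu≈1
  ... | no _  = *-identityˡ 1#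

  ∏-scaleAt : ∀ {n} (i : Fin n) u → ∏ (scaleAt i u) ≈ u
  ∏-scaleAt i u = trans (∏-single (scaleAt i u) i (scaleAt-off i u)) (scaleAt-at i u)

module Determinant {c ℓ : Level} (R : CommutativeRing c ℓ) where
  open CommutativeRing R hiding (zero)
  open import Relation.Binary.Reasoning.Setoid setoid
  open IntegerSolver R
  open MatrixAlgebra R

  Det : ∀ {n} → Matrix n → Carrier
  Det = det R

  Minor : ∀ {n} → Matrix (suc n) → Fin (suc n) → Matrix n
  Minor = minor R

  sgn : ℕ → Carrier
  sgn = sign R

  expansionTerm : ∀ {n} → Matrix (suc n) → Fin (suc n) → Carrier
  expansionTerm A j = sgn (F.toℕ j) * (A zero j * Det (Minor A j))

  Det-cong : ∀ {n} {A B : Matrix n} → A ≋ B → Det A ≈ Det B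
  Det-cong {zero}  A≋B = refl
  Det-cong {suc n} A≋B = ∑-cong {suc n} (λ j → *-congˡ {sgn (F.toℕ j)}
    (*-cong (A≋B zero j) (Det-cong (λ r s → A≋B (suc r) (punchIn j s)))))

  punchIn-avoids : ∀ {n} (j q : Fin (suc n)) (j≢q : ¬ j P.≡ q) (s : Fin n) →
    ¬ s P.≡ F.punchOut j≢q → ¬ punchIn j s P.≡ q
  punchIn-avoids j q j≢q s s≢q' eq =
    s≢q' (FP.punchIn-injective j s _ (P.trans eq (P.sym (FP.punchIn-punchOut j≢q))))

  Det-linear : ∀ {n} (A B C : Matrix n) (q : Fin n) (y : Carrier) →
    (∀ r s → ¬ s P.≡ q → C r s ≈ A r s) → (∀ r s → ¬ s P.≡ q → B r s ≈ A r s) →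
    (∀ r → C r q ≈ A r q + y * B r q) → Det C ≈ Det A + y * Det B
  Det-linear {suc n} A B C q y C≈A B≈A Cq = begin
    ∑ (expansionTerm C)
      ≈⟨ ∑-cong {suc n} term ⟩
    ∑ (λ j → expansionTerm A j + y * expansionTerm B j)
      ≈⟨ ∑-+ {suc n} (expansionTerm A) (λ j → y * expansionTerm B j) ⟩
    Det A + ∑ (λ j → y * expansionTerm B j)
      ≈⟨ +-congˡ (sym (∑-*ˡ {suc n} y (expansionTerm B))) ⟩
    Det A + y * Det B ∎
    where
    term : ∀ j → expansionTerm C j ≈ expansionTerm A j + y * expansionTerm B j
    term j with j F.≟ q
    ... | yes P.refl = begin
      sgn (F.toℕ j) * (C zero j * Det (Minor C j))
        ≈⟨ *-congˡ (*-cong (Cq zero) (Det-cong minorC)) ⟩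
      sgn (F.toℕ j) * ((A zero j + y * B zero j) * Det (Minor A j))
        ≈⟨ solve 5 (λ s a y b d → s :* ((a :+ y :* b) :* d) := s :* (a :* d) :+ y :* (s :* (b :* d))) refl _ _ _ _ _ ⟩
      expansionTerm A j + y * (sgn (F.toℕ j) * (B zero j * Det (Minor A j)))
        ≈⟨ +-congˡ (*-congˡ (*-congˡ (*-congˡ (Det-cong (≋-sym minorB))))) ⟩
      expansionTerm A j + y * expansionTerm B j ∎
      where
      minorC : Minor C j ≋ Minor A j
      minorC r s = C≈A (suc r) (punchIn j s) (FP.punchInᵢ≢i j s)
      minorB : Minor B j ≋ Minor A j
      minorB r s = B≈A (suc r) (punchIn j s) (FP.punchInᵢ≢i j s)
    ... | no j≢q = begin
      sgn (F.toℕ j) * (C zero j * Det (Minor C j))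
        ≈⟨ *-congˡ (*-cong (C≈A zero j j≢q) minor-linear) ⟩
      sgn (F.toℕ j) * (A zero j * (Det (Minor A j) + y * Det (Minor B j)))
        ≈⟨ solve 5 (λ s a y d e → s :* (a :* (d :+ y :* e)) := s :* (a :* d) :+ y :* (s :* (a :* e))) refl _ _ _ _ _ ⟩
      expansionTerm A j + y * (sgn (F.toℕ j) * (A zero j * Det (Minor B j)))
        ≈⟨ +-congˡ (*-congˡ (*-congˡ (*-congʳ (sym (B≈A zero j j≢q))))) ⟩
      expansionTerm A j + y * expansionTerm B j ∎
      where
      q' : Fin n
      q' = F.punchOut j≢q
      q'↦q : punchIn j q' P.≡ q
      q'↦q = FP.punchIn-punchOut j≢q
      minor-linear : Det (Minor C j) ≈ Det (Minor A j) + y * Det (Minor B j)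
      minor-linear = Det-linear (Minor A j) (Minor B j) (Minor C j) q' y
        (λ r s ne → C≈A (suc r) (punchIn j s) (punchIn-avoids j q j≢q s ne))
        (λ r s ne → B≈A (suc r) (punchIn j s) (punchIn-avoids j q j≢q s ne))
        (λ r → P.subst (λ t → C (suc r) t ≈ A (suc r) t + y * B (suc r) t) (P.sym q'↦q) (Cq (suc r)))

  addCol : ∀ {n} → Fin n → Fin n → Carrier → Matrix n → Matrix n
  addCol k j y A r s = pick (s F.≟ k) (A r k + y * A r j) (A r s)

  addCol-at : ∀ {n} (k j : Fin n) y (A : Matrix n) r s → s P.≡ k → addCol k j y A r s ≈ A r k + y * A r j
  addCol-at k j y A r s s≡k = pick-yes (s F.≟ k) _ _ s≡k

  addCol-off : ∀ {n} (k j : Fin n) y (A : Matrix n) r s → ¬ s P.≡ k → addCol k j y A r s ≈ A r s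
  addCol-off k j y A r s s≢k = pick-no (s F.≟ k) _ _ s≢k

  addCol-formula : ∀ {n} (k j : Fin n) y (A : Matrix n) r s → addCol k j y A r s ≈ A r s + I k s * (y * A r j)
  addCol-formula k j y A r s with s F.≟ k
  ... | yes P.refl = +-congˡ (sym (trans (*-congʳ (I-diag k)) (*-identityˡ _)))
  ... | no s≢k     = sym (trans (+-congˡ (trans (*-congʳ (I-off k s (λ eq → s≢k (P.sym eq)))) (zeroˡ _))) (+-identityʳ _))

  addCol-cong : ∀ {n} (k j : Fin n) y {A B : Matrix n} → A ≋ B → addCol k j y A ≋ addCol k j y B
  addCol-cong k j y A≋B r s with s F.≟ k
  ... | yes _ = +-cong (A≋B r k) (*-congˡ (A≋B r j))
  ... | no _  = A≋B r s

  addCol-coef : ∀ {n} (k j : Fin n) {y y'} (A : Matrix n) → y ≈ y' → addCol k j y A ≋ addCol k j y' A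
  addCol-coef k j A y≈y' r s with s F.≟ k
  ... | yes _ = +-congˡ (*-congʳ y≈y')
  ... | no _  = refl

  -- a column operation is right multiplication by an elementary matrix,
  -- hence commutes with left multiplication
  addCol-⊙ : ∀ {n} (k j : Fin n) y (A B : Matrix n) → addCol k j y (A ⊙ B) ≋ A ⊙ addCol k j y B
  addCol-⊙ {n} k j y A B r s with s F.≟ k
  ... | yes _ = begin
    ∑ (λ p → A r p * B p k) + y * ∑ (λ p → A r p * B p j)  ≈⟨ +-congˡ (∑-*ˡ {n} y _) ⟩
    ∑ (λ p → A r p * B p k) + ∑ (λ p → y * (A r p * B p j))  ≈⟨ sym (∑-+ {n} _ _) ⟩
    ∑ (λ p → A r p * B p k + y * (A r p * B p j))
      ≈⟨ ∑-cong {n} (λ p → solve 4 (λ a b y c → a :* b :+ y :* (a :* c) := a :* (b :+ y :* c)) refl _ _ _ _) ⟩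
    ∑ (λ p → A r p * (B p k + y * B p j)) ∎
  ... | no _ = refl

  addCol-undo : ∀ {n} (k j : Fin n) y → ¬ k P.≡ j → (A : Matrix n) → addCol k j (- y) (addCol k j y A) ≋ A
  addCol-undo k j y k≢j A r s with s F.≟ k
  ... | yes P.refl = trans (+-cong (addCol-at k j y A r k P.refl) (*-congˡ (addCol-off k j y A r j (λ eq → k≢j (P.sym eq)))))
                           (solve 3 (λ a y b → (a :+ y :* b) :+ (:- y) :* b := a) refl _ _ _)
  ... | no _ = refl

  data Adjacent : ∀ {n} → Fin n → Fin n → Set where
    adj-first : ∀ {n} → Adjacent {suc (suc n)} zero (suc zero)
    adj-suc   : ∀ {n} {j k : Fin n} → Adjacent j k → Adjacent {suc n} (suc j) (suc k)

  Adjacent-toℕ : ∀ {n} {j k : Fin n} → Adjacent j k → F.toℕ k P.≡ suc (F.toℕ j)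
  Adjacent-toℕ adj-first   = P.refl
  Adjacent-toℕ (adj-suc a) = P.cong suc (Adjacent-toℕ a)

  toℕ-Adjacent : ∀ {n} (j k : Fin n) → F.toℕ k P.≡ suc (F.toℕ j) → Adjacent j k
  toℕ-Adjacent zero    (suc zero)    eq = adj-first
  toℕ-Adjacent (suc j) (suc k)       eq = adj-suc (toℕ-Adjacent j k (ℕP.suc-injective eq))
  toℕ-Adjacent zero    zero          ()
  toℕ-Adjacent zero    (suc (suc k)) ()
  toℕ-Adjacent (suc j) zero          ()

  Adjacent-≢ : ∀ {n} {j k : Fin n} → Adjacent j k → ¬ j P.≡ k
  Adjacent-≢ a j≡k = ℕP.1+n≢n (P.sym (P.trans (P.cong F.toℕ j≡k) (Adjacent-toℕ a)))

  Adjacent-minor : ∀ {n} {j k : Fin (suc n)} (m : Fin (suc n)) → Adjacent j k → ¬ m P.≡ j → ¬ m P.≡ k →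
    Σ (Fin n) λ j' → Σ (Fin n) λ k' → Adjacent j' k' × punchIn m j' P.≡ j × punchIn m k' P.≡ k
  Adjacent-minor zero       adj-first m≢j m≢k = ⊥-elim (m≢j P.refl)
  Adjacent-minor (suc zero) adj-first m≢j m≢k = ⊥-elim (m≢k P.refl)
  Adjacent-minor {suc (suc n)} (suc (suc m)) adj-first m≢j m≢k = zero , suc zero , adj-first , P.refl , P.refl
  Adjacent-minor zero (adj-suc {j = j} {k = k} a) m≢j m≢k = j , k , a , P.refl , P.refl
  Adjacent-minor {suc n} (suc m) (adj-suc a) m≢j m≢k
    with Adjacent-minor m a (λ eq → m≢j (P.cong suc eq)) (λ eq → m≢k (P.cong suc eq))
  ... | j' , k' , a' , j'↦j , k'↦k = suc j' , suc k' , adj-suc a' , P.cong suc j'↦j , P.cong suc k'↦k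

  Adjacent-punchIn : ∀ {n} {j k : Fin (suc n)} → Adjacent j k → ∀ s →
    (punchIn j s P.≡ k × punchIn k s P.≡ j) ⊎ (punchIn j s P.≡ punchIn k s)
  Adjacent-punchIn adj-first zero    = inj₁ (P.refl , P.refl)
  Adjacent-punchIn adj-first (suc s) = inj₂ P.refl
  Adjacent-punchIn (adj-suc a) zero  = inj₂ P.refl
  Adjacent-punchIn {suc n} (adj-suc a) (suc s) with Adjacent-punchIn a s
  ... | inj₁ (e₁ , e₂) = inj₁ (P.cong suc e₁ , P.cong suc e₂)
  ... | inj₂ e         = inj₂ (P.cong suc e)

  Neighbours : ∀ {n} → Fin n → Fin n → Set
  Neighbours j k = Adjacent j k ⊎ Adjacent k j

  Neighbours-punchIn : ∀ {n} {j k : Fin (suc n)} → Neighbours j k → ∀ s →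
    (punchIn j s P.≡ k × punchIn k s P.≡ j) ⊎ (punchIn j s P.≡ punchIn k s)
  Neighbours-punchIn (inj₁ a) s = Adjacent-punchIn a s
  Neighbours-punchIn (inj₂ a) s with Adjacent-punchIn a s
  ... | inj₁ (e₁ , e₂) = inj₁ (e₂ , e₁)
  ... | inj₂ e         = inj₂ (P.sym e)

  Neighbours-≢ : ∀ {n} {j k : Fin n} → Neighbours j k → ¬ j P.≡ k
  Neighbours-≢ (inj₁ a)     = Adjacent-≢ a
  Neighbours-≢ (inj₂ a) j≡k = Adjacent-≢ a (P.sym j≡k)

  Neighbours-minor : ∀ {n} {j k : Fin (suc n)} (m : Fin (suc n)) → Neighbours j k → ¬ m P.≡ j → ¬ m P.≡ k →
    Σ (Fin n) λ j' → Σ (Fin n) λ k' → Neighbours j' k' × punchIn m j' P.≡ j × punchIn m k' P.≡ k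
  Neighbours-minor m (inj₁ a) m≢j m≢k with Adjacent-minor m a m≢j m≢k
  ... | j' , k' , a' , e₁ , e₂ = j' , k' , inj₁ a' , e₁ , e₂
  Neighbours-minor m (inj₂ a) m≢j m≢k with Adjacent-minor m a m≢k m≢j
  ... | k' , j' , a' , e₁ , e₂ = j' , k' , inj₂ a' , e₂ , e₁

  Neighbours-sgn : ∀ {n} {j k : Fin n} → Neighbours j k → sgn (F.toℕ k) + sgn (F.toℕ j) ≈ 0#
  Neighbours-sgn (inj₁ a) = trans (+-congʳ (reflexive (P.cong sgn (Adjacent-toℕ a)))) (-‿inverseˡ _)
  Neighbours-sgn (inj₂ a) = trans (+-congˡ (reflexive (P.cong sgn (Adjacent-toℕ a)))) (-‿inverseʳ _)

  -- In the expansion along row 0 the terms at k and at j each acquire the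
  -- extra summand ± y · A₀ⱼ · Det (Minor A k) (for the term at j because
  -- deleting j from the modified matrix leaves column j in the slot of k);
  -- they cancel since neighbouring signs are opposite.  All other terms are
  -- unchanged by induction.
  Det-addCol-neighbours : ∀ {n} (A : Matrix n) (j k : Fin n) (y : Carrier) → Neighbours j k →
    Det (addCol k j y A) ≈ Det A
  Det-addCol-neighbours {suc n} A j k y nb = begin
    ∑ (expansionTerm B)                       ≈⟨ ∑-cong {suc n} term ⟩
    ∑ (λ m → expansionTerm A m + y * extra m)  ≈⟨ ∑-+ {suc n} (expansionTerm A) (λ m → y * extra m) ⟩
    Det A + ∑ (λ m → y * extra m)              ≈⟨ +-congˡ (sym (∑-*ˡ {suc n} y extra)) ⟩
    Det A + y * ∑ extra                        ≈⟨ +-congˡ (*-congˡ extras-cancel) ⟩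
    Det A + y * 0#                             ≈⟨ trans (+-congˡ (zeroʳ y)) (+-identityʳ _) ⟩
    Det A ∎
    where
    B : Matrix (suc n)
    B = addCol k j y A
    j≢k : ¬ j P.≡ k
    j≢k = Neighbours-≢ nb
    shift : Carrier
    shift = A zero j * Det (Minor A k)
    extraAt : Fin (suc n) → Fin (suc n) → Carrier
    extraAt p m = pick (m F.≟ p) (sgn (F.toℕ p) * shift) 0#
    extra : Fin (suc n) → Carrier
    extra m = extraAt k m + extraAt j m

    ∑-extraAt : ∀ p → ∑ (extraAt p) ≈ sgn (F.toℕ p) * shift
    ∑-extraAt p = trans (∑-single {suc n} (extraAt p) p (λ i i≢p → pick-no (i F.≟ p) _ _ i≢p))
                        (pick-yes (p F.≟ p) _ _ P.refl)

    extras-cancel : ∑ extra ≈ 0#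
    extras-cancel = begin
      ∑ extra                                   ≈⟨ ∑-+ {suc n} (extraAt k) (extraAt j) ⟩
      ∑ (extraAt k) + ∑ (extraAt j)             ≈⟨ +-cong (∑-extraAt k) (∑-extraAt j) ⟩
      sgn (F.toℕ k) * shift + sgn (F.toℕ j) * shift     ≈⟨ sym (distribʳ _ _ _) ⟩
      (sgn (F.toℕ k) + sgn (F.toℕ j)) * shift       ≈⟨ *-congʳ (Neighbours-sgn nb) ⟩
      0# * shift                                    ≈⟨ zeroˡ _ ⟩
      0# ∎

    -- deleting column k: the minor is unchanged
    term-at-k : expansionTerm B k ≈ expansionTerm A k + y * extra k
    term-at-k = begin
      sgn (F.toℕ k) * (B zero k * Det (Minor B k))
        ≈⟨ *-congˡ (*-cong (addCol-at k j y A zero k P.refl) (Det-cong minor-unchanged)) ⟩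
      sgn (F.toℕ k) * ((A zero k + y * A zero j) * Det (Minor A k))
        ≈⟨ solve 5 (λ s a y b d → s :* ((a :+ y :* b) :* d) := s :* (a :* d) :+ y :* (s :* (b :* d) :+ K0)) refl _ _ _ _ _ ⟩
      expansionTerm A k + y * (sgn (F.toℕ k) * shift + 0#)
        ≈⟨ +-congˡ (*-congˡ (sym (+-cong (pick-yes (k F.≟ k) _ _ P.refl) (pick-no (k F.≟ j) _ _ (λ eq → j≢k (P.sym eq)))))) ⟩
      expansionTerm A k + y * extra k ∎
      where
      minor-unchanged : Minor B k ≋ Minor A k
      minor-unchanged r s = addCol-off k j y A (suc r) (punchIn k s) (FP.punchInᵢ≢i k s)

    -- deleting column j: by linearity in the slot k' of column k, the minor
    -- becomes Minor A j plus y times a matrix equal to Minor A k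
    term-at-j : expansionTerm B j ≈ expansionTerm A j + y * extra j
    term-at-j = begin
      sgn (F.toℕ j) * (B zero j * Det (Minor B j))
        ≈⟨ *-congˡ (*-cong (addCol-off k j y A zero j j≢k) minor-linear) ⟩
      sgn (F.toℕ j) * (A zero j * (Det (Minor A j) + y * Det (Minor A k)))
        ≈⟨ solve 5 (λ s a d y e → s :* (a :* (d :+ y :* e)) := s :* (a :* d) :+ y :* (K0 :+ s :* (a :* e))) refl _ _ _ _ _ ⟩
      expansionTerm A j + y * (0# + sgn (F.toℕ j) * shift)
        ≈⟨ +-congˡ (*-congˡ (sym (+-cong (pick-no (j F.≟ k) _ _ j≢k) (pick-yes (j F.≟ j) _ _ P.refl)))) ⟩
      expansionTerm A j + y * extra j ∎
      where
      k' : Fin n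
      k' = F.punchOut j≢k
      k'↦k : punchIn j k' P.≡ k
      k'↦k = FP.punchIn-punchOut j≢k
      -- Minor A j with column k' replaced by the (deleted) column j
      N : Matrix n
      N r s = pick (s F.≟ k') (A (suc r) j) (A (suc r) (punchIn j s))
      N≋ : N ≋ Minor A k
      N≋ r s with s F.≟ k' | Neighbours-punchIn nb s
      ... | yes P.refl | inj₁ (_ , e) = reflexive (P.cong (A (suc r)) (P.sym e))
      ... | yes P.refl | inj₂ e       = ⊥-elim (FP.punchInᵢ≢i k k' (P.trans (P.sym e) k'↦k))
      ... | no s≢k'    | inj₁ (e , _) = ⊥-elim (punchIn-avoids j k j≢k s s≢k' e)
      ... | no _       | inj₂ e       = reflexive (P.cong (A (suc r)) e)
      minor-linear : Det (Minor B j) ≈ Det (Minor A j) + y * Det (Minor A k)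
      minor-linear = trans (Det-linear (Minor A j) N (Minor B j) k' y
        (λ r s ne → addCol-off k j y A (suc r) (punchIn j s) (punchIn-avoids j k j≢k s ne))
        (λ r s ne → pick-no (s F.≟ k') _ _ ne)
        (λ r → trans (addCol-at k j y A (suc r) (punchIn j k') k'↦k)
           (+-cong (reflexive (P.cong (A (suc r)) (P.sym k'↦k))) (*-congˡ (sym (pick-yes (k' F.≟ k') _ _ P.refl))))))
        (+-congˡ (*-congˡ (Det-cong N≋)))

    -- deleting another column m: the minor undergoes the same operation
    term-elsewhere : ∀ m → ¬ m P.≡ k → ¬ m P.≡ j → expansionTerm B m ≈ expansionTerm A m + y * extra m
    term-elsewhere m m≢k m≢j = begin
      sgn (F.toℕ m) * (B zero m * Det (Minor B m))
        ≈⟨ *-congˡ (*-cong (addCol-off k j y A zero m m≢k) minor-invariant) ⟩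
      expansionTerm A m
        ≈⟨ solve 2 (λ t y → t := t :+ y :* (K0 :+ K0)) refl _ _ ⟩
      expansionTerm A m + y * (0# + 0#)
        ≈⟨ +-congˡ (*-congˡ (sym (+-cong (pick-no (m F.≟ k) _ _ m≢k) (pick-no (m F.≟ j) _ _ m≢j)))) ⟩
      expansionTerm A m + y * extra m ∎
      where
      pair : Σ (Fin n) λ j' → Σ (Fin n) λ k' → Neighbours j' k' × punchIn m j' P.≡ j × punchIn m k' P.≡ k
      pair = Neighbours-minor m nb m≢j m≢k
      j' k' : Fin n
      j' = proj₁ pair
      k' = proj₁ (proj₂ pair)
      nb' : Neighbours j' k'
      nb' = proj₁ (proj₂ (proj₂ pair))
      j'↦j : punchIn m j' P.≡ j
      j'↦j = proj₁ (proj₂ (proj₂ (proj₂ pair)))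
      k'↦k : punchIn m k' P.≡ k
      k'↦k = proj₂ (proj₂ (proj₂ (proj₂ pair)))
      minor-commutes : Minor B m ≋ addCol k' j' y (Minor A m)
      minor-commutes r s with s F.≟ k'
      ... | yes P.refl = trans (addCol-at k j y A (suc r) (punchIn m s) k'↦k)
          (+-cong (reflexive (P.cong (A (suc r)) (P.sym k'↦k))) (*-congˡ (reflexive (P.cong (A (suc r)) (P.sym j'↦j)))))
      ... | no s≢k' = addCol-off k j y A (suc r) (punchIn m s)
          (λ eq → s≢k' (FP.punchIn-injective m s k' (P.trans eq (P.sym k'↦k))))
      minor-invariant : Det (Minor B m) ≈ Det (Minor A m)
      minor-invariant = trans (Det-cong minor-commutes) (Det-addCol-neighbours (Minor A m) j' k' y nb')

    term-cases : ∀ m → Dec (m P.≡ k) → Dec (m P.≡ j) → expansionTerm B m ≈ expansionTerm A m + y * extra m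
    term-cases m (yes P.refl) (yes m≡j)  = ⊥-elim (j≢k (P.sym m≡j))
    term-cases m (yes P.refl) (no _)     = term-at-k
    term-cases m (no _)       (yes P.refl) = term-at-j
    term-cases m (no m≢k)     (no m≢j)   = term-elsewhere m m≢k m≢j

    term : ∀ m → expansionTerm B m ≈ expansionTerm A m + y * extra m
    term m = term-cases m (m F.≟ k) (m F.≟ j)

  addCol-commutator : ∀ {n} (A : Matrix n) (j m k : Fin n) y → ¬ j P.≡ m → ¬ m P.≡ k → ¬ j P.≡ k →
    addCol k m (- y) (addCol m j (- 1#) (addCol k m y (addCol m j 1# A))) ≋ addCol k j y A
  addCol-commutator A j m k y j≢m m≢k j≢k r s = cases (s F.≟ k) (s F.≟ m)
    where
    A₁ A₂ A₃ : Matrix _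
    A₁ = addCol m j 1# A
    A₂ = addCol k m y A₁
    A₃ = addCol m j (- 1#) A₂
    k≢m : ¬ k P.≡ m
    k≢m eq = m≢k (P.sym eq)
    A₃k : A₃ r k ≈ A r k + y * (A r m + 1# * A r j)
    A₃k = trans (addCol-off m j (- 1#) A₂ r k k≢m) (trans (addCol-at k m y A₁ r k P.refl)
            (+-cong (addCol-off m j 1# A r k k≢m) (*-congˡ (addCol-at m j 1# A r m P.refl))))
    A₃m : A₃ r m ≈ (A r m + 1# * A r j) + (- 1#) * A r j
    A₃m = trans (addCol-at m j (- 1#) A₂ r m P.refl)
            (+-cong (trans (addCol-off k m y A₁ r m m≢k) (addCol-at m j 1# A r m P.refl))
                    (*-congˡ (trans (addCol-off k m y A₁ r j j≢k) (addCol-off m j 1# A r j j≢m))))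
    cases : Dec (s P.≡ k) → Dec (s P.≡ m) → addCol k m (- y) A₃ r s ≈ addCol k j y A r s
    cases (yes P.refl) _ = begin
      addCol k m (- y) A₃ r k
        ≈⟨ addCol-at k m (- y) A₃ r k P.refl ⟩
      A₃ r k + (- y) * A₃ r m
        ≈⟨ +-cong A₃k (*-congˡ A₃m) ⟩
      (A r k + y * (A r m + 1# * A r j)) + (- y) * ((A r m + 1# * A r j) + (- 1#) * A r j)
        ≈⟨ solve 4 (λ a b c y → (a :+ y :* (b :+ K1 :* c)) :+ (:- y) :* ((b :+ K1 :* c) :+ (:- K1) :* c) := a :+ y :* c) refl _ _ _ _ ⟩
      A r k + y * A r j
        ≈⟨ sym (addCol-at k j y A r k P.refl) ⟩
      addCol k j y A r k ∎
    cases (no s≢k) (yes P.refl) = begin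
      addCol k m (- y) A₃ r m                ≈⟨ addCol-off k m (- y) A₃ r m s≢k ⟩
      A₃ r m                                 ≈⟨ A₃m ⟩
      (A r m + 1# * A r j) + (- 1#) * A r j  ≈⟨ solve 2 (λ b c → (b :+ K1 :* c) :+ (:- K1) :* c := b) refl _ _ ⟩
      A r m                                  ≈⟨ sym (addCol-off k j y A r m s≢k) ⟩
      addCol k j y A r m ∎
    cases (no s≢k) (no s≢m) = begin
      addCol k m (- y) A₃ r s  ≈⟨ addCol-off k m (- y) A₃ r s s≢k ⟩
      A₃ r s                   ≈⟨ addCol-off m j (- 1#) A₂ r s s≢m ⟩
      A₂ r s                   ≈⟨ addCol-off k m y A₁ r s s≢k ⟩
      A₁ r s                   ≈⟨ addCol-off m j 1# A r s s≢m ⟩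
      A r s                    ≈⟨ sym (addCol-off k j y A r s s≢k) ⟩
      addCol k j y A r s ∎

  -- invariance for columns at distance d + 1, in both directions, by
  -- induction on d: route the operation through the column next to k
  Det-addCol-distance : ∀ d {n} (j k : Fin n) → F.toℕ k P.≡ suc (d ℕ.+ F.toℕ j) → ∀ (A : Matrix n) y →
    (Det (addCol k j y A) ≈ Det A) × (Det (addCol j k y A) ≈ Det A)
  Det-addCol-distance zero j k k=j+1 A y =
    Det-addCol-neighbours A j k y (inj₁ adj) , Det-addCol-neighbours A k j y (inj₂ adj)
    where
    adj : Adjacent j k
    adj = toℕ-Adjacent j k k=j+1
  Det-addCol-distance (suc d) j zero () A y
  Det-addCol-distance (suc d) {suc n} j (suc k₀) k=j+d+2 A y = rightward , leftward
    where
    k : Fin (suc n)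
    k = suc k₀
    m : Fin (suc n)
    m = F.inject₁ k₀
    m=j+d+1 : F.toℕ m P.≡ suc (d ℕ.+ F.toℕ j)
    m=j+d+1 = P.trans (FP.toℕ-inject₁ k₀) (ℕP.suc-injective k=j+d+2)
    m~k : Adjacent m k
    m~k = toℕ-Adjacent m k (P.cong suc (P.sym (FP.toℕ-inject₁ k₀)))
    j≢m : ¬ j P.≡ m
    j≢m eq = ℕP.m≢1+n+m (F.toℕ j) (P.trans (P.cong F.toℕ eq) m=j+d+1)
    m≢k : ¬ m P.≡ k
    m≢k = Adjacent-≢ m~k
    j≢k : ¬ j P.≡ k
    j≢k eq = ℕP.m≢1+n+m (F.toℕ j) (P.trans (P.cong F.toℕ eq) k=j+d+2)
    j↔m : ∀ (A : Matrix (suc n)) y → (Det (addCol m j y A) ≈ Det A) × (Det (addCol j m y A) ≈ Det A)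
    j↔m = Det-addCol-distance d j m m=j+d+1
    rightward : Det (addCol k j y A) ≈ Det A
    rightward = begin
      Det (addCol k j y A)
        ≈⟨ sym (Det-cong (addCol-commutator A j m k y j≢m m≢k j≢k)) ⟩
      Det (addCol k m (- y) (addCol m j (- 1#) (addCol k m y (addCol m j 1# A))))
        ≈⟨ Det-addCol-neighbours (addCol m j (- 1#) (addCol k m y (addCol m j 1# A))) m k (- y) (inj₁ m~k) ⟩
      Det (addCol m j (- 1#) (addCol k m y (addCol m j 1# A)))
        ≈⟨ proj₁ (j↔m (addCol k m y (addCol m j 1# A)) (- 1#)) ⟩
      Det (addCol k m y (addCol m j 1# A))
        ≈⟨ Det-addCol-neighbours (addCol m j 1# A) m k y (inj₁ m~k) ⟩
      Det (addCol m j 1# A)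
        ≈⟨ proj₁ (j↔m A 1#) ⟩
      Det A ∎
    leftward : Det (addCol j k y A) ≈ Det A
    leftward = begin
      Det (addCol j k y A)
        ≈⟨ sym (Det-cong (addCol-commutator A k m j y (λ eq → m≢k (P.sym eq)) (λ eq → j≢m (P.sym eq)) (λ eq → j≢k (P.sym eq)))) ⟩
      Det (addCol j m (- y) (addCol m k (- 1#) (addCol j m y (addCol m k 1# A))))
        ≈⟨ proj₂ (j↔m (addCol m k (- 1#) (addCol j m y (addCol m k 1# A))) (- y)) ⟩
      Det (addCol m k (- 1#) (addCol j m y (addCol m k 1# A)))
        ≈⟨ Det-addCol-neighbours (addCol j m y (addCol m k 1# A)) k m (- 1#) (inj₂ m~k) ⟩
      Det (addCol j m y (addCol m k 1# A))
        ≈⟨ proj₂ (j↔m (addCol m k 1# A) y) ⟩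
      Det (addCol m k 1# A)
        ≈⟨ Det-addCol-neighbours A k m 1# (inj₂ m~k) ⟩
      Det A ∎

  distance : ∀ {a b} → a ℕ.< b → b P.≡ suc ((b ℕ.∸ suc a) ℕ.+ a)
  distance {a} a<b = P.trans (P.sym (ℕP.m∸n+n≡m a<b)) (ℕP.+-suc _ a)

  Det-addCol : ∀ {n} (A : Matrix n) (k j : Fin n) y → ¬ k P.≡ j → Det (addCol k j y A) ≈ Det A
  Det-addCol A k j y k≢j with ℕP.<-cmp (F.toℕ j) (F.toℕ k)
  ... | tri< j<k _ _ = proj₁ (Det-addCol-distance _ j k (distance j<k) A y)
  ... | tri≈ _ j=k _ = ⊥-elim (k≢j (P.sym (FP.toℕ-injective j=k)))
  ... | tri> _ _ k<j = proj₂ (Det-addCol-distance _ k j (distance k<j) A y)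

  Det-I : ∀ {n} → Det (I {n}) ≈ 1#
  Det-I {zero}  = refl
  Det-I {suc n} = begin
    1# * (1# * Det (Minor (I {suc n}) zero)) + ∑ (λ j → sgn (F.toℕ (suc j)) * (0# * Det (Minor (I {suc n}) (suc j))))
      ≈⟨ +-cong (trans (*-identityˡ _) (*-identityˡ _)) (∑-zero {n} _ (λ j → trans (*-congˡ (zeroˡ _)) (zeroʳ _))) ⟩
    Det (I {n}) + 0#  ≈⟨ trans (+-identityʳ _) (Det-I {n}) ⟩
    1# ∎

  Det-diagonal : ∀ {n} (D : Matrix n) (d : Fin n → Carrier) →
    (∀ r s → ¬ r P.≡ s → D r s ≈ 0#) → (∀ r → D r r ≈ d r) → Det D ≈ ∏ d
  Det-diagonal {zero}  D d off diag = refl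
  Det-diagonal {suc n} D d off diag = begin
    1# * (D zero zero * Det (Minor D zero)) + ∑ (λ j → sgn (F.toℕ (suc j)) * (D zero (suc j) * Det (Minor D (suc j))))
      ≈⟨ +-cong (trans (*-identityˡ _) (*-cong (diag zero) minor-diagonal))
                (∑-zero {n} _ (λ j → trans (*-congˡ (trans (*-congʳ (off zero (suc j) (λ ()))) (zeroˡ _))) (zeroʳ _))) ⟩
    ∏ d + 0#  ≈⟨ +-identityʳ _ ⟩
    ∏ d ∎
    where
    minor-diagonal : Det (Minor D zero) ≈ ∏ (λ i → d (suc i))
    minor-diagonal = Det-diagonal (Minor D zero) (λ i → d (suc i))
      (λ r s r≢s → off (suc r) (suc s) (λ eq → r≢s (FP.suc-injective eq))) (λ r → diag (suc r))

  Det-diagonal-matrix : ∀ {n} (d : Fin n → Carrier) → Det (diagonal d) ≈ ∏ d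
  Det-diagonal-matrix d = Det-diagonal (diagonal d) d (λ r s r≢s → trans (*-congʳ (I-off r s r≢s)) (zeroˡ _))
    (λ r → trans (*-congʳ (I-diag r)) (*-identityˡ _))

  Det-first-row-zero : ∀ {n} (C : Matrix (suc n)) → (∀ s → C zero (suc s) ≈ 0#) →
    Det C ≈ C zero zero * Det (Minor C zero)
  Det-first-row-zero {n} C row≈0 = trans (+-cong (*-identityˡ _)
      (∑-zero {n} _ (λ j → trans (*-congˡ (trans (*-congʳ (row≈0 j)) (zeroˡ _))) (zeroʳ _))))
    (+-identityʳ _)

  Det-addCol-I : ∀ {n} (k j : Fin n) y → ¬ k P.≡ j → Det (addCol k j y (I {n})) ≈ 1#
  Det-addCol-I {n} k j y k≢j = trans (Det-addCol I k j y k≢j) (Det-I {n})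

module Adic {c ℓ : Level} (R : CommutativeRing c ℓ) (π : CommutativeRing.Carrier R) where
  open CommutativeRing R hiding (zero)
  open import Relation.Binary.Reasoning.Setoid setoid
  open RingWithoutOneProperties (Ring.ringWithoutOne ring) using (-‿distribˡ-*)
  open IntegerSolver R
  open MatrixAlgebra R
  open Determinant R

  π^[_] : ℕ → Carrier
  π^[ m ] = _^_ R π m

  record π^_∣_ (m : ℕ) (x : Carrier) : Set (c ⊔ ℓ) where
    constructor _,_
    field
      quotient : Carrier
      proof    : quotient * π^[ m ] ≈ x

  fromDivides : ∀ {m x} → _∣_ R π^[ m ] x → π^ m ∣ x
  fromDivides (k , p) = k , p

  toDivides : ∀ {m x} → π^ m ∣ x → _∣_ R π^[ m ] x
  toDivides (k , p) = k , p

  _≡_mod_ : Carrier → Carrier → ℕ → Set (c ⊔ ℓ)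
  x ≡ y mod m = π^ m ∣ (x - y)

  _≡ₘ_mod_ : ∀ {n} → Matrix n → Matrix n → ℕ → Set (c ⊔ ℓ)
  A ≡ₘ B mod m = ∀ i j → A i j ≡ B i j mod m

  π^[]-+ : ∀ a b → π^[ a ℕ.+ b ] ≈ π^[ a ] * π^[ b ]
  π^[]-+ zero    b = sym (*-identityˡ _)
  π^[]-+ (suc a) b = trans (*-congˡ (π^[]-+ a b)) (sym (*-assoc _ _ _))

  ∣-zero : ∀ m → π^ m ∣ 0#
  ∣-zero m = 0# , zeroˡ _

  ∣-cong : ∀ {m x y} → x ≈ y → π^ m ∣ x → π^ m ∣ y
  ∣-cong x≈y (k , p) = k , trans p x≈y

  ∣-+ : ∀ {m x y} → π^ m ∣ x → π^ m ∣ y → π^ m ∣ (x + y)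
  ∣-+ (k , p) (l , q) = k + l , trans (distribʳ _ _ _) (+-cong p q)

  ∣-neg : ∀ {m x} → π^ m ∣ x → π^ m ∣ (- x)
  ∣-neg (k , p) = - k , trans (sym (-‿distribˡ-* _ _)) (-‿cong p)

  ∣-*ˡ : ∀ {m} a {x} → π^ m ∣ x → π^ m ∣ (a * x)
  ∣-*ˡ a (k , p) = a * k , trans (*-assoc _ _ _) (*-congˡ p)

  ∣-*ʳ : ∀ {m} a {x} → π^ m ∣ x → π^ m ∣ (x * a)
  ∣-*ʳ a d = ∣-cong (*-comm _ _) (∣-*ˡ a d)

  ∣-π^ : ∀ m x → π^ m ∣ (π^[ m ] * x)
  ∣-π^ m x = x , *-comm _ _

  π^-∣-π^ : ∀ m → π^ m ∣ π^[ m ]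
  π^-∣-π^ m = ∣-cong (*-identityʳ π^[ m ]) (∣-π^ m 1#)

  ∣-* : ∀ {a b x y} → π^ a ∣ x → π^ b ∣ y → π^ (a ℕ.+ b) ∣ (x * y)
  ∣-* {a} {b} (k , p) (l , q) = k * l , (begin
    k * l * π^[ a ℕ.+ b ]        ≈⟨ *-congˡ (π^[]-+ a b) ⟩
    k * l * (π^[ a ] * π^[ b ])  ≈⟨ interchange-* _ _ _ _ ⟩
    k * π^[ a ] * (l * π^[ b ])  ≈⟨ *-cong p q ⟩
    _ ∎)

  ∣-weaken : ∀ {a b x} → a ℕ.≤ b → π^ b ∣ x → π^ a ∣ x
  ∣-weaken {a} {b} {x} a≤b (k , p) = k * π^[ b ℕ.∸ a ] , (begin
    k * π^[ b ℕ.∸ a ] * π^[ a ]    ≈⟨ *-assoc _ _ _ ⟩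
    k * (π^[ b ℕ.∸ a ] * π^[ a ])  ≈⟨ *-congˡ (sym (π^[]-+ (b ℕ.∸ a) a)) ⟩
    k * π^[ b ℕ.∸ a ℕ.+ a ]        ≡⟨ P.cong (λ t → k * π^[ t ]) (ℕP.m∸n+n≡m a≤b) ⟩
    k * π^[ b ]                    ≈⟨ p ⟩
    x ∎)

  ∣-*-square : ∀ {M x y} → 1 ℕ.≤ M → π^ M ∣ x → π^ M ∣ y → π^ (suc M) ∣ (x * y)
  ∣-*-square {M} 1≤M dx dy = ∣-weaken (P.subst (λ t → t ℕ.≤ M ℕ.+ M) (ℕP.+-comm M 1) (ℕP.+-monoʳ-≤ M 1≤M)) (∣-* dx dy)

  ∣-∑ : ∀ {n m} (f : Fin n → Carrier) → (∀ i → π^ m ∣ f i) → π^ m ∣ ∑ f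
  ∣-∑ {zero}  {m} f d = ∣-zero m
  ∣-∑ {suc n}     f d = ∣-+ (d zero) (∣-∑ (λ i → f (suc i)) (λ i → d (suc i)))

  ≡-refl : ∀ {m x} → x ≡ x mod m
  ≡-refl {m} {x} = ∣-cong (sym (-‿inverseʳ x)) (∣-zero m)

  ≡-reflexive : ∀ {m x y} → x ≈ y → x ≡ y mod m
  ≡-reflexive {m} {x} {y} x≈y = ∣-cong (trans (sym (-‿inverseʳ y)) (+-congʳ (sym x≈y))) (∣-zero m)

  ≡-sym : ∀ {m x y} → x ≡ y mod m → y ≡ x mod m
  ≡-sym {m} {x} {y} d = ∣-cong (solve 2 (λ x y → :- (x :- y) := y :- x) refl x y) (∣-neg d)

  ≡-trans : ∀ {m x y z} → x ≡ y mod m → y ≡ z mod m → x ≡ z mod m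
  ≡-trans {m} {x} {y} {z} d e = ∣-cong (solve 3 (λ x y z → (x :- y) :+ (y :- z) := x :- z) refl x y z) (∣-+ d e)

  ≡-+ : ∀ {m x y x' y'} → x ≡ x' mod m → y ≡ y' mod m → (x + y) ≡ (x' + y') mod m
  ≡-+ {m} {x} {y} {x'} {y'} d e =
    ∣-cong (solve 4 (λ x y x' y' → (x :- x') :+ (y :- y') := (x :+ y) :- (x' :+ y')) refl x y x' y') (∣-+ d e)

  ≡-* : ∀ {m x y x' y'} → x ≡ x' mod m → y ≡ y' mod m → (x * y) ≡ (x' * y') mod m
  ≡-* {m} {x} {y} {x'} {y'} d e =
    ∣-cong (solve 4 (λ x y x' y' → (x :- x') :* y :+ x' :* (y :- y') := x :* y :- x' :* y') refl x y x' y')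
           (∣-+ (∣-*ʳ y d) (∣-*ˡ x' e))

  ≡-∑ : ∀ {n m} (f g : Fin n → Carrier) → (∀ i → f i ≡ g i mod m) → ∑ f ≡ ∑ g mod m
  ≡-∑ {zero}  f g d = ≡-refl
  ≡-∑ {suc n} f g d = ≡-+ (d zero) (≡-∑ (λ i → f (suc i)) (λ i → g (suc i)) (λ i → d (suc i)))

  ≡-zero⇒∣ : ∀ {m x} → x ≡ 0# mod m → π^ m ∣ x
  ≡-zero⇒∣ {m} {x} = ∣-cong (trans (+-congˡ -0≈0) (+-identityʳ x))

  ∣⇒≡-zero : ∀ {m x} → π^ m ∣ x → x ≡ 0# mod m
  ∣⇒≡-zero {m} {x} = ∣-cong (sym (trans (+-congˡ -0≈0) (+-identityʳ x)))

  ≡ₘ-refl : ∀ {n m} {A : Matrix n} → A ≡ₘ A mod m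
  ≡ₘ-refl i j = ≡-refl

  ≡ₘ-reflexive : ∀ {n m} {A B : Matrix n} → A ≋ B → A ≡ₘ B mod m
  ≡ₘ-reflexive A≋B i j = ≡-reflexive (A≋B i j)

  ≡ₘ-sym : ∀ {n m} {A B : Matrix n} → A ≡ₘ B mod m → B ≡ₘ A mod m
  ≡ₘ-sym d i j = ≡-sym (d i j)

  ≡ₘ-trans : ∀ {n m} {A B C : Matrix n} → A ≡ₘ B mod m → B ≡ₘ C mod m → A ≡ₘ C mod m
  ≡ₘ-trans d e i j = ≡-trans (d i j) (e i j)

  ≡ₘ-⊙ : ∀ {n m} {A A' B B' : Matrix n} → A ≡ₘ A' mod m → B ≡ₘ B' mod m → (A ⊙ B) ≡ₘ (A' ⊙ B') mod m
  ≡ₘ-⊙ {n} {m} {A} {A'} {B} {B'} d e i j =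
    ≡-∑ {n} (λ k → A i k * B k j) (λ k → A' i k * B' k j) (λ k → ≡-* (d i k) (e k j))

  ∣-Det-column : ∀ {n m} (A : Matrix n) (q : Fin n) → (∀ r → π^ m ∣ A r q) → π^ m ∣ Det A
  ∣-Det-column {suc n} {m} A q d = ∣-∑ {suc n} _ term
    where
    term : ∀ j → π^ m ∣ expansionTerm A j
    term j with j F.≟ q
    ... | yes P.refl = ∣-*ˡ _ (∣-*ʳ _ (d zero))
    ... | no j≢q = ∣-*ˡ _ (∣-*ˡ _ (∣-Det-column (Minor A j) (F.punchOut j≢q)
          (λ r → P.subst (λ t → π^ m ∣ A (suc r) t) (P.sym (FP.punchIn-punchOut j≢q)) (d (suc r)))))

  ∣-Det-first-row : ∀ {n m} (A : Matrix (suc n)) → (∀ s → π^ m ∣ A zero s) → π^ m ∣ Det A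
  ∣-Det-first-row {n} A d = ∣-∑ {suc n} _ (λ j → ∣-*ˡ (sgn (F.toℕ j)) (∣-*ʳ (Det (Minor A j)) (d j)))

  Det-near-I : ∀ {n} M (X A : Matrix n) → 1 ℕ.≤ M → (∀ r s → A r s ≈ I r s + π^[ M ] * X r s) →
    Det A ≡ (1# + π^[ M ] * tr X) mod (suc M)
  Det-near-I {zero}  M X A 1≤M A≈ = ≡-reflexive (sym (trans (+-congˡ (zeroʳ _)) (+-identityʳ _)))
  Det-near-I {suc n} M X A 1≤M A≈ = ≡-trans leading-term (≡-reflexive (+-congˡ (sym (distribˡ _ _ _))))
    where
    X' : Matrix n
    X' r s = X (suc r) (suc s)
    a b : Carrier
    a = π^[ M ] * X zero zero
    b = π^[ M ] * tr X'
    minor₀ : Det (Minor A zero) ≡ (1# + b) mod (suc M)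
    minor₀ = Det-near-I M X' (Minor A zero) 1≤M (λ r s → A≈ (suc r) (suc s))
    off-diagonal : ∀ {r s} → ¬ r P.≡ s → π^ M ∣ A r s
    off-diagonal {r} {s} r≢s = ∣-cong (sym (trans (A≈ r s) (trans (+-congʳ (I-off r s r≢s)) (+-identityˡ _)))) (∣-π^ M _)
    -- the other terms are products of two entries divisible by π^M
    other-terms : ∀ j → π^ (suc M) ∣ expansionTerm A (suc j)
    other-terms j = ∣-*ˡ _ (∣-*-square 1≤M (off-diagonal (λ ())) (∣-Det-column (Minor A (suc j)) (F.punchOut z≢)
        (λ r → P.subst (λ t → π^ M ∣ A (suc r) t) (P.sym (FP.punchIn-punchOut z≢)) (off-diagonal (λ ())))))
      where
      z≢ : ¬ suc j P.≡ zero
      z≢ ()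
    leading-term : Det A ≡ (1# + (a + b)) mod (suc M)
    leading-term = ≡-trans (≡-+ (≡-* ≡-refl (≡-* (≡-reflexive (A≈ zero zero)) minor₀))
                                (∣⇒≡-zero (∣-∑ {n} _ other-terms)))
      (∣-cong (solve 2 (λ a b → a :* b := (K1 :* ((K1 :+ a) :* (K1 :+ b)) :+ K0) :- (K1 :+ (a :+ b))) refl a b)
              (∣-*-square 1≤M (∣-π^ M _) (∣-π^ M _)))

module ColumnOperations {c ℓ : Level} (R : CommutativeRing c ℓ) where
  open CommutativeRing R hiding (zero)
  open import Relation.Binary.Reasoning.Setoid setoid
  open IntegerSolver R
  open MatrixAlgebra R
  open Determinant R

  record ColOp (n : ℕ) : Set c where
    constructor colOp
    field
      tgt src : Fin n
      coef    : Carrier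
      tgt≢src : ¬ tgt P.≡ src

  applyOp : ∀ {n} → ColOp n → Matrix n → Matrix n
  applyOp (colOp k j y _) = addCol k j y

  applyOps : ∀ {n} → List (ColOp n) → Matrix n → Matrix n
  applyOps []       A = A
  applyOps (o ∷ os) A = applyOps os (applyOp o A)

  applyOps-++ : ∀ {n} (xs ys : List (ColOp n)) A → applyOps (xs ++ ys) A P.≡ applyOps ys (applyOps xs A)
  applyOps-++ []       ys A = P.refl
  applyOps-++ (x ∷ xs) ys A = applyOps-++ xs ys (applyOp x A)

  applyOps-cong : ∀ {n} (os : List (ColOp n)) {A B} → A ≋ B → applyOps os A ≋ applyOps os B
  applyOps-cong []                     A≋B = A≋B
  applyOps-cong (colOp k j y _ ∷ os) A≋B = applyOps-cong os (addCol-cong k j y A≋B)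

  applyOps-⊙ : ∀ {n} (os : List (ColOp n)) (A B : Matrix n) → applyOps os (A ⊙ B) ≋ A ⊙ applyOps os B
  applyOps-⊙ []                   A B = ≋-refl
  applyOps-⊙ (colOp k j y _ ∷ os) A B =
    ≋-trans (applyOps-cong os (addCol-⊙ k j y A B)) (applyOps-⊙ os A (addCol k j y B))

  Det-applyOps : ∀ {n} (os : List (ColOp n)) (A : Matrix n) → Det (applyOps os A) ≈ Det A
  Det-applyOps []                     A = refl
  Det-applyOps (colOp k j y k≢j ∷ os) A = trans (Det-applyOps os (addCol k j y A)) (Det-addCol A k j y k≢j)

  inverseOps : ∀ {n} → List (ColOp n) → List (ColOp n)
  inverseOps []                     = []
  inverseOps (colOp k j y k≢j ∷ os) = inverseOps os ++ (colOp k j (- y) k≢j ∷ [])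

  inverseOps-undo : ∀ {n} (os : List (ColOp n)) (A : Matrix n) → applyOps (inverseOps os) (applyOps os A) ≋ A
  inverseOps-undo []                         A = ≋-refl
  inverseOps-undo (o@(colOp k j y k≢j) ∷ os) A
    rewrite applyOps-++ (inverseOps os) (colOp k j (- y) k≢j ∷ []) (applyOps os (applyOp o A)) =
    ≋-trans (addCol-cong k j (- y) (inverseOps-undo os (applyOp o A))) (addCol-undo k j y k≢j A)

  _↝_ : ∀ {n} → Matrix n → Matrix n → Set (c ⊔ ℓ)
  _↝_ {n} A B = Σ (List (ColOp n)) λ os → applyOps os A ≋ B

  ↝-trans : ∀ {n} {A B C : Matrix n} → A ↝ B → B ↝ C → A ↝ C
  ↝-trans {A = A} (os , A↦B) (os' , B↦C) = os ++ os' ,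
    P.subst (λ T → T ≋ _) (P.sym (applyOps-++ os os' A)) (≋-trans (applyOps-cong os' A↦B) B↦C)

  ↝-op : ∀ {n} (o : ColOp n) (A : Matrix n) → A ↝ applyOp o A
  ↝-op o A = o ∷ [] , ≋-refl

  Det-↝ : ∀ {n} {A B : Matrix n} → A ↝ B → Det B ≈ Det A
  Det-↝ {A = A} (os , A↦B) = trans (sym (Det-cong A↦B)) (Det-applyOps os A)

  applyOps-common-source : ∀ {n m} (h : Fin m → Fin n) (j : Fin n) (f : Fin m → Carrier) (ne : ∀ i → ¬ h i P.≡ j) →
    ∀ (B : Matrix n) r s → applyOps (Data.List.tabulate (λ i → colOp (h i) j (f i) (ne i))) B r s ≈
                           B r s + ∑ (λ i → pick (h i F.≟ s) (f i) 0#) * B r j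
  applyOps-common-source {m = zero}  h j f ne B r s = sym (trans (+-congˡ (zeroˡ _)) (+-identityʳ _))
  applyOps-common-source {m = suc m} h j f ne B r s = begin
    applyOps (Data.List.tabulate (λ i → colOp (h (suc i)) j (f (suc i)) (ne (suc i)))) B₁ r s
      ≈⟨ applyOps-common-source (λ i → h (suc i)) j (λ i → f (suc i)) (λ i → ne (suc i)) B₁ r s ⟩
    B₁ r s + rest * B₁ r j
      ≈⟨ +-cong (first-step (s F.≟ h zero)) (*-congˡ (addCol-off (h zero) j (f zero) B r j (λ eq → ne zero (P.sym eq)))) ⟩
    (B r s + pick (h zero F.≟ s) (f zero) 0# * B r j) + rest * B r j
      ≈⟨ trans (+-assoc _ _ _) (+-congˡ (sym (distribʳ _ _ _))) ⟩
    B r s + (pick (h zero F.≟ s) (f zero) 0# + rest) * B r j ∎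
    where
    B₁ : Matrix _
    B₁ = addCol (h zero) j (f zero) B
    rest : Carrier
    rest = ∑ (λ i → pick (h (suc i) F.≟ s) (f (suc i)) 0#)
    first-step : Dec (s P.≡ h zero) → B₁ r s ≈ B r s + pick (h zero F.≟ s) (f zero) 0# * B r j
    first-step (yes P.refl) = trans (addCol-at (h zero) j (f zero) B r s P.refl)
      (+-congˡ (*-congʳ (sym (pick-yes (h zero F.≟ s) _ _ P.refl))))
    first-step (no s≢h₀) = trans (addCol-off (h zero) j (f zero) B r s s≢h₀)
      (sym (trans (+-congˡ (trans (*-congʳ (pick-no (h zero F.≟ s) _ _ (λ eq → s≢h₀ (P.sym eq)))) (zeroˡ _))) (+-identityʳ _)))

  applyOps-common-target : ∀ {n m} (k : Fin n) (h : Fin m → Fin n) (f : Fin m → Carrier) (ne : ∀ i → ¬ k P.≡ h i) →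
    ∀ (B : Matrix n) r s → applyOps (Data.List.tabulate (λ i → colOp k (h i) (f i) (ne i))) B r s ≈
                           pick (s F.≟ k) (B r k + ∑ (λ i → f i * B r (h i))) (B r s)
  applyOps-common-target {m = zero} k h f ne B r s with s F.≟ k
  ... | yes P.refl = sym (+-identityʳ _)
  ... | no _       = refl
  applyOps-common-target {m = suc m} k h f ne B r s =
    trans (applyOps-common-target k (λ i → h (suc i)) (λ i → f (suc i)) (λ i → ne (suc i)) B₁ r s) (first-step (s F.≟ k))
    where
    B₁ : Matrix _
    B₁ = addCol k (h zero) (f zero) B
    B₁-sources : ∀ i → B₁ r (h i) ≈ B r (h i)
    B₁-sources i = addCol-off k (h zero) (f zero) B r (h i) (λ eq → ne i (P.sym eq))
    first-step : (d : Dec (s P.≡ k)) → pick d (B₁ r k + ∑ (λ i → f (suc i) * B₁ r (h (suc i)))) (B₁ r s)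
                                      ≈ pick d (B r k + ∑ (λ i → f i * B r (h i))) (B r s)
    first-step (yes P.refl) = trans (+-cong (addCol-at k (h zero) (f zero) B r k P.refl)
      (∑-cong {m} (λ i → *-congˡ (B₁-sources (suc i))))) (+-assoc _ _ _)
    first-step (no s≢k) = addCol-off k (h zero) (f zero) B r s s≢k

  shiftOp : ∀ {n} → ColOp n → ColOp (suc n)
  shiftOp (colOp k j y k≢j) = colOp (suc k) (suc j) y (λ eq → k≢j (FP.suc-injective eq))

  record SameBorder {n} (C D : Matrix (suc n)) : Set ℓ where
    field
      corner    : D zero zero ≈ C zero zero
      row-zero  : ∀ s → D zero (suc s) ≈ 0#
      first-col : ∀ r → D (suc r) zero ≈ C (suc r) zero

  shiftOp-acts : ∀ {n} (o : ColOp n) (C : Matrix (suc n)) → (∀ s → C zero (suc s) ≈ 0#) →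
    SameBorder C (applyOp (shiftOp o) C) × (Minor (applyOp (shiftOp o) C) zero ≋ applyOp o (Minor C zero))
  shiftOp-acts (colOp k j y k≢j) C row≈0 = border , on-minor
    where
    row-zero : ∀ s → addCol (suc k) (suc j) y C zero (suc s) ≈ 0#
    row-zero s with s F.≟ k
    ... | yes P.refl = trans (+-cong (row≈0 k) (*-congˡ (row≈0 j))) (trans (+-congˡ (zeroʳ y)) (+-identityʳ 0#))
    ... | no _       = row≈0 s
    border : SameBorder C (addCol (suc k) (suc j) y C)
    border = record { corner = refl ; row-zero = row-zero ; first-col = λ r → refl }
    on-minor : Minor (addCol (suc k) (suc j) y C) zero ≋ addCol k j y (Minor C zero)
    on-minor r s with s F.≟ k
    ... | yes P.refl = refl
    ... | no _       = refl

  shiftOps-act : ∀ {n} (os : List (ColOp n)) (C : Matrix (suc n)) → (∀ s → C zero (suc s) ≈ 0#) →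
    SameBorder C (applyOps (Data.List.map shiftOp os) C) ×
    (Minor (applyOps (Data.List.map shiftOp os) C) zero ≋ applyOps os (Minor C zero))
  shiftOps-act []       C row≈0 = record { corner = refl ; row-zero = row≈0 ; first-col = λ r → refl } , ≋-refl
  shiftOps-act (o ∷ os) C row≈0 with shiftOp-acts o C row≈0
  ... | b₁ , m₁ with shiftOps-act os (applyOp (shiftOp o) C) (SameBorder.row-zero b₁)
  ...   | b₂ , m₂ = record { corner    = trans (SameBorder.corner b₂) (SameBorder.corner b₁)
                           ; row-zero  = SameBorder.row-zero b₂
                           ; first-col = λ r → trans (SameBorder.first-col b₂ r) (SameBorder.first-col b₁ r) } ,
                    ≋-trans m₂ (applyOps-cong os m₁)

module ResidueField {c ℓ : Level} (R : CommutativeRing c ℓ) (π : CommutativeRing.Carrier R)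
  (dvr : IsDVR R π) (q : ℕ) (res : ResidueFieldCard R π q) where
  open CommutativeRing R hiding (zero)
  open import Relation.Binary.Reasoning.Setoid setoid
  open IntegerSolver R
  open Adic R π
  open IsDVR dvr

  Unit : Carrier → Set (c ⊔ ℓ)
  Unit = IsUnit R

  Unit-cong : ∀ {x y} → x ≈ y → Unit x → Unit y
  Unit-cong x≈y (v , xv≈1) = v , trans (*-congʳ (sym x≈y)) xv≈1

  Unit-* : ∀ {x y} → Unit x → Unit y → Unit (x * y)
  Unit-* {x} {y} (a , xa≈1) (b , yb≈1) = a * b , trans (interchange-* x y a b) (trans (*-cong xa≈1 yb≈1) (*-identityˡ 1#))

  rep : Fin q → Carrier
  rep = proj₁ res

  rep-injective : ∀ i j → rep i ≡ rep j mod 1 → i P.≡ j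
  rep-injective i j d = proj₁ (proj₂ res) i j (toDivides d)

  residue : ∀ x → Σ (Fin q) λ i → x ≡ rep i mod 1
  residue x = proj₁ (proj₂ (proj₂ res) x) , fromDivides (proj₂ (proj₂ (proj₂ res) x))

  ¬π∣1 : ¬ π^ 1 ∣ 1#
  ¬π∣1 (k , kπ≈1) = π-nonunit (k , trans (*-comm π k) (trans (*-congˡ (sym (*-identityʳ π))) kπ≈1))

  -- x is divisible by π iff it has the residue of 0
  π∣? : ∀ x → Dec (π^ 1 ∣ x)
  π∣? x with residue x | residue 0#
  ... | i , x≡i | i₀ , 0≡i₀ with i F.≟ i₀
  ... | yes P.refl = yes (≡-zero⇒∣ (≡-trans x≡i (≡-sym 0≡i₀)))
  ... | no i≢i₀    = no (λ π∣x → i≢i₀ (rep-injective i i₀ (≡-trans (≡-sym x≡i) (≡-trans (∣⇒≡-zero π∣x) 0≡i₀))))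

  ¬π∣⇒Unit : ∀ x → ¬ π^ 1 ∣ x → Unit x
  ¬π∣⇒Unit x ¬π∣x with valuation x (λ x≈0 → ¬π∣x (∣-cong (sym x≈0) (∣-zero 1)))
  ... | u , zero , (v , uv≈1) , x≈u = v , (begin
    x * v         ≈⟨ *-congʳ x≈u ⟩
    u * 1# * v    ≈⟨ *-congʳ (*-identityʳ u) ⟩
    u * v         ≈⟨ uv≈1 ⟩
    1# ∎)
  ... | u , suc m , _ , x≈uπᵐ⁺¹ = ⊥-elim (¬π∣x (u * π^[ m ] , (begin
    u * π^[ m ] * (π * 1#)  ≈⟨ *-congˡ (*-identityʳ π) ⟩
    u * π^[ m ] * π         ≈⟨ *-assoc _ _ _ ⟩
    u * (π^[ m ] * π)       ≈⟨ *-congˡ (*-comm _ _) ⟩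
    u * (π * π^[ m ])       ≈⟨ sym x≈uπᵐ⁺¹ ⟩
    x ∎)))

  find-unit : ∀ {m} (f : Fin m → Carrier) → (Σ (Fin m) λ t → Unit (f t)) ⊎ (∀ j → π^ 1 ∣ f j)
  find-unit {zero}  f = inj₂ (λ ())
  find-unit {suc m} f with π∣? (f zero)
  ... | no ¬π∣f₀ = inj₁ (zero , ¬π∣⇒Unit (f zero) ¬π∣f₀)
  ... | yes π∣f₀ with find-unit (λ i → f (suc i))
  ...   | inj₁ (t , u) = inj₁ (suc t , u)
  ...   | inj₂ π∣fs    = inj₂ (λ { zero → π∣f₀ ; (suc j) → π∣fs j })

  -- The witness is kept opaque: only the statement is used, and unfolding
  -- the residue search while checking its uses would be very costly.
  opaque
    -- When |k| ≥ 4 some residue differs from 0, 1 and -1: its representative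
    -- u is a unit with u² - 1 = (u - 1)(u + 1) a unit.
    unit-with-unit-square-minus-one : 4 ℕ.≤ q → Σ Carrier λ u → Unit u × Unit (u * u - 1#)
    unit-with-unit-square-minus-one 4≤q =
      u , ¬π∣⇒Unit u ¬π∣u ,
      Unit-cong (solve 1 (λ u → (u :- K1) :* (u :- (:- K1)) := u :* u :- K1) refl u)
                (Unit-* (¬π∣⇒Unit _ ¬π∣u-1) (¬π∣⇒Unit _ ¬π∣u+1))
      where
      embed : Fin 4 → Fin q
      embed a = F.inject≤ a 4≤q
      i₀ i₁ i₋₁ : Fin q
      i₀  = proj₁ (residue 0#)
      i₁  = proj₁ (residue 1#)
      i₋₁ = proj₁ (residue (- 1#))
      special : Fin 3 → Fin q
      special zero             = i₀
      special (suc zero)       = i₁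
      special (suc (suc zero)) = i₋₁
      IsSpecial : Fin 4 → Set
      IsSpecial a = Σ (Fin 3) λ t → embed a P.≡ special t
      special? : ∀ a → Dec (IsSpecial a)
      special? a = FP.any? (λ t → embed a F.≟ special t)
      -- by the pigeonhole principle not all four residues embed a are special
      generic : Σ (Fin 4) λ a → ¬ IsSpecial a
      generic with FP.all? special?
      ... | no ¬all = FP.¬∀⟶∃¬ 4 IsSpecial special? ¬all
      ... | yes all with FP.pigeonhole (ℕP.n<1+n 3) (λ a → proj₁ (all a))
      ...   | a , b , a<b , same = ⊥-elim (FP.<⇒≢ a<b (FP.inject≤-injective 4≤q 4≤q a b
                (P.trans (proj₂ (all a)) (P.trans (P.cong special same) (P.sym (proj₂ (all b)))))))
      a : Fin 4
      a = proj₁ generic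
      u : Carrier
      u = rep (embed a)
      not-special : ∀ t x → x ≡ rep (special t) mod 1 → ¬ u ≡ x mod 1
      not-special t x x≡ u≡x = proj₂ generic (t , rep-injective (embed a) (special t) (≡-trans u≡x x≡))
      ¬π∣u : ¬ π^ 1 ∣ u
      ¬π∣u π∣u = not-special zero 0# (proj₂ (residue 0#)) (∣⇒≡-zero π∣u)
      ¬π∣u-1 : ¬ π^ 1 ∣ (u - 1#)
      ¬π∣u-1 = not-special (suc zero) 1# (proj₂ (residue 1#))
      ¬π∣u+1 : ¬ π^ 1 ∣ (u - (- 1#))
      ¬π∣u+1 = not-special (suc (suc zero)) (- 1#) (proj₂ (residue (- 1#)))

-- Gaussian elimination: over the DVR R every matrix of determinant 1 is
-- reduced to I by column operations.  Consequently it has a two-sided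
-- inverse, and right multiplication by that inverse preserves determinants.
module Elimination {c ℓ : Level} (R : CommutativeRing c ℓ) (π : CommutativeRing.Carrier R)
  (dvr : IsDVR R π) (q : ℕ) (res : ResidueFieldCard R π q) where
  open CommutativeRing R hiding (zero)
  open import Relation.Binary.Reasoning.Setoid setoid
  open IntegerSolver R
  open MatrixAlgebra R
  open Determinant R
  open ColumnOperations R
  open Adic R π
  open ResidueField R π dvr q res

  clear-first-column : ∀ {n} (D : Matrix (suc n)) → D zero zero ≈ 1# → (∀ s → D zero (suc s) ≈ 0#) →
    Minor D zero ≋ I → D ↝ I
  clear-first-column {n} D D₀₀≈1 row≈0 minor≋I = ops , cleared
    where
    f : Fin n → Carrier
    f i = - D (suc i) zero
    ops : List (ColOp (suc n))
    ops = Data.List.tabulate (λ i → colOp zero (suc i) (f i) (λ ()))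
    result : ∀ r s → applyOps ops D r s ≈ pick (s F.≟ zero) (D r zero + ∑ (λ i → f i * D r (suc i))) (D r s)
    result = applyOps-common-target zero suc f (λ i ()) D
    cleared : applyOps ops D ≋ I
    cleared zero zero = begin
      applyOps ops D zero zero                     ≈⟨ result zero zero ⟩
      D zero zero + ∑ (λ i → f i * D zero (suc i))
        ≈⟨ +-cong D₀₀≈1 (∑-zero {n} _ (λ i → trans (*-congˡ (row≈0 i)) (zeroʳ (f i)))) ⟩
      1# + 0#                                      ≈⟨ +-identityʳ 1# ⟩
      1# ∎
    cleared (suc r) zero = begin
      applyOps ops D (suc r) zero                  ≈⟨ result (suc r) zero ⟩
      D (suc r) zero + ∑ (λ i → f i * D (suc r) (suc i))
        ≈⟨ +-congˡ (∑-single {n} (λ i → f i * D (suc r) (suc i)) r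
             (λ i i≢r → trans (*-congˡ (trans (minor≋I r i) (I-off r i (λ eq → i≢r (P.sym eq))))) (zeroʳ (f i)))) ⟩
      D (suc r) zero + f r * D (suc r) (suc r)     ≈⟨ +-congˡ (*-congˡ (trans (minor≋I r r) (I-diag r))) ⟩
      D (suc r) zero + f r * 1#                    ≈⟨ +-congˡ (*-identityʳ (f r)) ⟩
      D (suc r) zero - D (suc r) zero              ≈⟨ -‿inverseʳ (D (suc r) zero) ⟩
      0# ∎
    cleared zero    (suc s) = trans (result zero (suc s)) (row≈0 s)
    cleared (suc r) (suc s) = trans (result (suc r) (suc s)) (minor≋I r s)

  clear-first-row : ∀ {n} (B : Matrix (suc n)) → B zero zero ≈ 1# →
    Σ (Matrix (suc n)) λ C → B ↝ C × (C zero zero ≈ 1#) × (∀ s → C zero (suc s) ≈ 0#)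
  clear-first-row {n} B B₀₀≈1 = C , (ops , ≋-refl) , C₀₀≈1 , row≈0
    where
    f : Fin n → Carrier
    f i = - B zero (suc i)
    ops : List (ColOp (suc n))
    ops = Data.List.tabulate (λ i → colOp (suc i) zero (f i) (λ ()))
    C : Matrix (suc n)
    C = applyOps ops B
    coef : Fin (suc n) → Carrier
    coef s = ∑ (λ i → pick (suc i F.≟ s) (f i) 0#)
    coef-zero : coef zero ≈ 0#
    coef-zero = ∑-zero {n} _ (λ i → refl)
    coef-suc : ∀ s → coef (suc s) ≈ f s
    coef-suc s = trans (∑-single {n} (λ i → pick (suc i F.≟ suc s) (f i) 0#) s
      (λ i i≢s → pick-no (suc i F.≟ suc s) (f i) 0# (λ eq → i≢s (FP.suc-injective eq))))
      (pick-yes (suc s F.≟ suc s) (f s) 0# P.refl)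
    result : ∀ r s → C r s ≈ B r s + coef s * B r zero
    result = applyOps-common-source suc zero f (λ i ()) B
    C₀₀≈1 : C zero zero ≈ 1#
    C₀₀≈1 = begin
      C zero zero                              ≈⟨ result zero zero ⟩
      B zero zero + coef zero * B zero zero    ≈⟨ +-congˡ (trans (*-congʳ coef-zero) (zeroˡ (B zero zero))) ⟩
      B zero zero + 0#                         ≈⟨ +-identityʳ (B zero zero) ⟩
      B zero zero                              ≈⟨ B₀₀≈1 ⟩
      1# ∎
    row≈0 : ∀ s → C zero (suc s) ≈ 0#
    row≈0 s = begin
      C zero (suc s)                                 ≈⟨ result zero (suc s) ⟩
      B zero (suc s) + coef (suc s) * B zero zero    ≈⟨ +-congˡ (*-cong (coef-suc s) B₀₀≈1) ⟩
      B zero (suc s) + (- B zero (suc s)) * 1#       ≈⟨ solve 1 (λ b → b :+ (:- b) :* K1 := K0) refl (B zero (suc s)) ⟩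
      0# ∎

  -- Since π ∤ Det A = 1, some entry of the first row is a unit; one or two
  -- column operations then make the corner entry 1.
  make-corner-one : ∀ {n} (A : Matrix (suc (suc n))) → Det A ≈ 1# →
    Σ (Matrix (suc (suc n))) λ B → A ↝ B × (B zero zero ≈ 1#)
  make-corner-one A DetA≈1 with find-unit (A zero)
  ... | inj₂ π∣row = ⊥-elim (¬π∣1 (∣-cong DetA≈1 (∣-Det-first-row A π∣row)))
  ... | inj₁ (suc t , (w , a·w≈1)) = applyOp to-corner A , ↝-op to-corner A , (begin
    addCol zero (suc t) y A zero zero        ≈⟨ addCol-at zero (suc t) y A zero zero P.refl ⟩
    A zero zero + y * A zero (suc t)
      ≈⟨ +-congˡ (solve 3 (λ a w u → ((K1 :- a) :* w) :* u := (K1 :- a) :* (u :* w)) refl (A zero zero) w (A zero (suc t))) ⟩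
    A zero zero + (1# - A zero zero) * (A zero (suc t) * w)  ≈⟨ +-congˡ (*-congˡ a·w≈1) ⟩
    A zero zero + (1# - A zero zero) * 1#   ≈⟨ solve 1 (λ a → a :+ (K1 :- a) :* K1 := K1) refl (A zero zero) ⟩
    1# ∎)
    where
    -- column 0 += (1 - A₀₀) · (A₀ₜ)⁻¹ · column t
    y : Carrier
    y = (1# - A zero zero) * w
    to-corner : ColOp _
    to-corner = colOp zero (suc t) y (λ ())
  ... | inj₁ (zero , (w , a·w≈1)) = applyOp op₂ A₁ , ↝-trans (↝-op op₁ A) (↝-op op₂ A₁) , (begin
    addCol zero (suc zero) 1# A₁ zero zero
      ≈⟨ addCol-at zero (suc zero) 1# A₁ zero zero P.refl ⟩
    A₁ zero zero + 1# * A₁ zero (suc zero)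
      ≈⟨ +-cong (addCol-off (suc zero) zero y A zero zero (λ ())) (*-congˡ (addCol-at (suc zero) zero y A zero (suc zero) P.refl)) ⟩
    A zero zero + 1# * (A zero (suc zero) + y * A zero zero)
      ≈⟨ +-congˡ (*-congˡ (+-congˡ (solve 4 (λ a b w u → ((K1 :- a :- b) :* w) :* u := (K1 :- a :- b) :* (u :* w))
           refl (A zero zero) (A zero (suc zero)) w (A zero zero)))) ⟩
    A zero zero + 1# * (A zero (suc zero) + (1# - A zero zero - A zero (suc zero)) * (A zero zero * w))
      ≈⟨ +-congˡ (*-congˡ (+-congˡ (*-congˡ a·w≈1))) ⟩
    A zero zero + 1# * (A zero (suc zero) + (1# - A zero zero - A zero (suc zero)) * 1#)
      ≈⟨ solve 2 (λ a b → a :+ K1 :* (b :+ (K1 :- a :- b) :* K1) := K1) refl (A zero zero) (A zero (suc zero)) ⟩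
    1# ∎)
    where
    -- first make A₀₁ = 1 - A₀₀, then add column 1 to column 0
    y : Carrier
    y = (1# - A zero zero - A zero (suc zero)) * w
    op₁ op₂ : ColOp _
    op₁ = colOp (suc zero) zero y (λ ())
    op₂ = colOp zero (suc zero) 1# (λ ())
    A₁ : Matrix _
    A₁ = applyOp op₁ A

  reduce-step : ∀ {n} (A : Matrix (suc (suc n))) → Det A ≈ 1# →
    (∀ (A' : Matrix (suc n)) → Det A' ≈ 1# → A' ↝ I) → A ↝ I
  reduce-step {n} A DetA≈1 reduce-minor with make-corner-one A DetA≈1
  ... | B , A↝B , B₀₀≈1 with clear-first-row B B₀₀≈1
  ... | C , B↝C , C₀₀≈1 , C-row≈0 = ↝-trans A↝B (↝-trans B↝C (↝-trans C↝D D↝I))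
    where
    DetC≈1 : Det C ≈ 1#
    DetC≈1 = trans (Det-↝ B↝C) (trans (Det-↝ A↝B) DetA≈1)
    Det-minor≈1 : Det (Minor C zero) ≈ 1#
    Det-minor≈1 = trans (sym (trans (*-congʳ C₀₀≈1) (*-identityˡ _))) (trans (sym (Det-first-row-zero C C-row≈0)) DetC≈1)
    minor-reduction : Minor C zero ↝ I
    minor-reduction = reduce-minor (Minor C zero) Det-minor≈1
    minor-ops : List (ColOp (suc n))
    minor-ops = proj₁ minor-reduction
    D : Matrix (suc (suc n))
    D = applyOps (Data.List.map shiftOp minor-ops) C
    C↝D : C ↝ D
    C↝D = Data.List.map shiftOp minor-ops , ≋-refl
    shifted : SameBorder C D × (Minor D zero ≋ applyOps minor-ops (Minor C zero))
    shifted = shiftOps-act minor-ops C C-row≈0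
    D↝I : D ↝ I
    D↝I = clear-first-column D (trans (SameBorder.corner (proj₁ shifted)) C₀₀≈1) (SameBorder.row-zero (proj₁ shifted))
            (≋-trans (proj₂ shifted) (proj₂ minor-reduction))

  reduce-to-I : ∀ {n} (A : Matrix n) → Det A ≈ 1# → A ↝ I
  reduce-to-I {zero}        A DetA≈1 = [] , (λ ())
  reduce-to-I {suc zero}    A DetA≈1 = [] , A≋I
    where
    A≋I : A ≋ I
    A≋I zero zero = trans (sym (trans (+-identityʳ _) (trans (*-identityˡ _) (*-identityʳ _)))) DetA≈1
  reduce-to-I {suc (suc n)} A DetA≈1 = reduce-step A DetA≈1 reduce-to-I

  record Inverse {n} (A : Matrix n) : Set (c ⊔ ℓ) where
    field
      inv       : Matrix n
      right-inv : A ⊙ inv ≋ I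
      left-inv  : inv ⊙ A ≋ I
      Det-⊙inv  : ∀ B → Det (B ⊙ inv) ≈ Det B

  -- If the operations os reduce A to I then Q = os(I) satisfies A Q = I, and
  -- Q' = os⁻¹(I) satisfies Q Q' = I, whence Q A = Q A Q Q' = Q Q' = I.
  SL-inverse : ∀ {n} (A : Matrix n) → Det A ≈ 1# → Inverse A
  SL-inverse {n} A DetA≈1 = record { inv = Q ; right-inv = AQ≋I ; left-inv = QA≋I ; Det-⊙inv = Det-⊙Q }
    where
    reduction : A ↝ I
    reduction = reduce-to-I A DetA≈1
    ops : List (ColOp n)
    ops = proj₁ reduction
    Q Q' : Matrix n
    Q  = applyOps ops I
    Q' = applyOps (inverseOps ops) I
    AQ≋I : A ⊙ Q ≋ I
    AQ≋I = ≋-trans (≋-sym (applyOps-⊙ ops A I)) (≋-trans (applyOps-cong ops (⊙-I A)) (proj₂ reduction))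
    QQ'≋I : Q ⊙ Q' ≋ I
    QQ'≋I = ≋-trans (≋-sym (applyOps-⊙ (inverseOps ops) Q I))
              (≋-trans (applyOps-cong (inverseOps ops) (⊙-I Q)) (inverseOps-undo ops I))
    QA≋I : Q ⊙ A ≋ I
    QA≋I = ≋-trans (≋-sym (⊙-I (Q ⊙ A))) (≋-trans (⊙-cong (≋-refl {A = Q ⊙ A}) (≋-sym QQ'≋I))
           (≋-trans (⊙-assoc Q A (Q ⊙ Q')) (≋-trans (⊙-cong (≋-refl {A = Q}) (≋-sym (⊙-assoc A Q Q')))
           (≋-trans (⊙-cong (≋-refl {A = Q}) (⊙-cong AQ≋I (≋-refl {A = Q'})))
           (≋-trans (⊙-cong (≋-refl {A = Q}) (I-⊙ Q')) QQ'≋I)))))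
    Det-⊙Q : ∀ B → Det (B ⊙ Q) ≈ Det B
    Det-⊙Q B = trans (Det-cong (≋-sym (applyOps-⊙ ops B I))) (trans (Det-applyOps ops (B ⊙ I)) (Det-cong (⊙-I B)))

module Lifting {c ℓ ℓ' : Level} (R : CommutativeRing c ℓ) (π : CommutativeRing.Carrier R)
  (dvr : IsDVR R π) (q : ℕ) (res : ResidueFieldCard R π q) (4≤q : 4 ℕ.≤ q)
  (n : ℕ) (H : Mat R n → Set ℓ') (subgroup : IsSubgroupSL R n H) (normal : IsNormalSL R n H)
  (surjective : SurjectsResidue R n π H) where
  open CommutativeRing R hiding (zero)
  open import Relation.Binary.Reasoning.Setoid setoid
  open IntegerSolver R
  open MatrixAlgebra R
  open Determinant R
  open Adic R π
  open ResidueField R π dvr q res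
  open Elimination R π dvr q res
  open IsSubgroupSL subgroup

  lift-mod-π : ∀ W → Det W ≈ 1# → Σ (Matrix n) λ h → H h × W ≡ₘ h mod 1
  lift-mod-π W DetW≈1 with surjective W (toDivides (≡-reflexive {1} DetW≈1))
  ... | h , h∈H , W≡h = h , h∈H , (λ i j → fromDivides (W≡h i j))

  HasLift : ℕ → Matrix n → Set (c ⊔ ℓ ⊔ ℓ')
  HasLift M Y = Σ (Matrix n) λ G → H G × (I ⊕ π^[ M ] ⋆ Y) ≡ₘ G mod (suc M)

  HasLift-mod-π : ∀ {M Y Z} → Y ≡ₘ Z mod 1 → HasLift M Y → HasLift M Z
  HasLift-mod-π {M} {Y} {Z} Y≡Z (G , G∈H , Y≡G) = G , G∈H , ≡ₘ-trans Z≡Y Y≡G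
    where
    Z≡Y : (I ⊕ π^[ M ] ⋆ Z) ≡ₘ (I ⊕ π^[ M ] ⋆ Y) mod (suc M)
    Z≡Y i j = ∣-cong (solve 4 (λ e p z y → p :* (z :- y) := (e :+ p :* z) :- (e :+ p :* y)) refl (I i j) π^[ M ] (Z i j) (Y i j))
      (P.subst (λ t → π^ t ∣ (π^[ M ] * (Z i j - Y i j))) (ℕP.+-comm M 1) (∣-* (π^-∣-π^ M) (≡ₘ-sym Y≡Z i j)))

  HasLift-≋ : ∀ {M Y Z} → Y ≋ Z → HasLift M Y → HasLift M Z
  HasLift-≋ Y≋Z = HasLift-mod-π (≡ₘ-reflexive Y≋Z)

  HasLift-O : ∀ M → HasLift M O
  HasLift-O M = I , hasId , (λ i j → ≡-reflexive (trans (+-congˡ (zeroʳ _)) (+-identityʳ _)))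

  -- (I + π^M Y)(I + π^M Z) ≡ I + π^M (Y + Z) modulo π^(M+1), as M ≥ 1
  HasLift-⊕ : ∀ {M Y Z} → 1 ℕ.≤ M → HasLift M Y → HasLift M Z → HasLift M (Y ⊕ Z)
  HasLift-⊕ {M} {Y} {Z} 1≤M (G₁ , G₁∈H , Y≡G₁) (G₂ , G₂∈H , Z≡G₂) = G₁ ⊙ G₂ , mulCl G₁ G₂ G₁∈H G₂∈H ,
      ≡ₘ-trans (≡ₘ-trans sum≡product (≡ₘ-reflexive (≋-sym expand))) (≡ₘ-⊙ Y≡G₁ Z≡G₂)
    where
    p : Carrier
    p = π^[ M ]
    expand : (I ⊕ p ⋆ Y) ⊙ (I ⊕ p ⋆ Z) ≋ (I ⊕ p ⋆ Y) ⊕ p ⋆ (Z ⊕ p ⋆ (Y ⊙ Z))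
    expand = ≋-trans (⊙-⊕ʳ (I ⊕ p ⋆ Y) I (p ⋆ Z)) (⊕-cong (⊙-I (I ⊕ p ⋆ Y)) (≋-trans (⊙-⋆ʳ p (I ⊕ p ⋆ Y) Z)
               (⋆-cong p (≋-trans (⊙-⊕ˡ I (p ⋆ Y) Z) (⊕-cong (I-⊙ Z) (⊙-⋆ˡ p Y Z))))))
    sum≡product : (I ⊕ p ⋆ (Y ⊕ Z)) ≡ₘ ((I ⊕ p ⋆ Y) ⊕ p ⋆ (Z ⊕ p ⋆ (Y ⊙ Z))) mod (suc M)
    sum≡product i j = ∣-cong (solve 5 (λ e p y z w → :- ((p :* p) :* w) := (e :+ p :* (y :+ z)) :- ((e :+ p :* y) :+ p :* (z :+ p :* w)))
        refl (I i j) p (Y i j) (Z i j) ((Y ⊙ Z) i j))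
      (∣-neg (∣-*ʳ ((Y ⊙ Z) i j) (∣-*-square 1≤M (π^-∣-π^ M) (π^-∣-π^ M))))

  HasLift-∑ : ∀ {M m} → 1 ℕ.≤ M → (Y : Fin m → Matrix n) → (∀ i → HasLift M (Y i)) →
    HasLift M (λ r s → ∑ (λ i → Y i r s))
  HasLift-∑ {M} {zero}  1≤M Y lifts = HasLift-≋ (λ r s → refl) (HasLift-O M)
  HasLift-∑ {M} {suc m} 1≤M Y lifts = HasLift-⊕ 1≤M (lifts zero) (HasLift-∑ 1≤M (λ i → Y (suc i)) (λ i → lifts (suc i)))

  commutator-expansion : ∀ M (h Q W W' N γ γ' : Matrix n) → 1 ℕ.≤ M → h ⊙ Q ≋ I →
    h ≡ₘ W mod 1 → Q ≡ₘ W' mod 1 → γ ≋ I ⊕ π^[ M ] ⋆ N → γ' ≋ I ⊕ π^[ M ] ⋆ ⊝ N →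
    (h ⊙ ((γ ⊙ Q) ⊙ γ')) ≡ₘ (I ⊕ π^[ M ] ⋆ ((W ⊙ (N ⊙ W')) ⊕ ⊝ N)) mod (suc M)
  commutator-expansion M h Q W W' N γ γ' 1≤M hQ≋I h≡W Q≡W' γ≋ γ'≋ =
    ≡ₘ-trans (≡ₘ-reflexive exact-expansion) drop-higher-terms
    where
    p : Carrier
    p = π^[ M ]
    X₀ Y₁ Y₂ : Matrix n
    X₀ = Q ⊕ p ⋆ (N ⊙ Q)
    Y₁ = h ⊙ (N ⊙ Q)
    Y₂ = Y₁ ⊙ ⊝ N
    γQ≋ : γ ⊙ Q ≋ X₀
    γQ≋ = ≋-trans (⊙-cong γ≋ (≋-refl {A = Q})) (≋-trans (⊙-⊕ˡ I (p ⋆ N) Q) (⊕-cong (I-⊙ Q) (⊙-⋆ˡ p N Q)))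
    γQγ'≋ : (γ ⊙ Q) ⊙ γ' ≋ X₀ ⊕ p ⋆ (X₀ ⊙ ⊝ N)
    γQγ'≋ = ≋-trans (⊙-cong γQ≋ γ'≋) (≋-trans (⊙-⊕ʳ X₀ I (p ⋆ ⊝ N)) (⊕-cong (⊙-I X₀) (⊙-⋆ʳ p X₀ (⊝ N))))
    hX₀≋ : h ⊙ X₀ ≋ I ⊕ p ⋆ Y₁
    hX₀≋ = ≋-trans (⊙-⊕ʳ h Q (p ⋆ (N ⊙ Q))) (⊕-cong hQ≋I (⊙-⋆ʳ p h (N ⊙ Q)))
    hX₀N≋ : h ⊙ (X₀ ⊙ ⊝ N) ≋ ⊝ N ⊕ p ⋆ Y₂
    hX₀N≋ = ≋-trans (≋-sym (⊙-assoc h X₀ (⊝ N))) (≋-trans (⊙-cong hX₀≋ (≋-refl {A = ⊝ N}))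
              (≋-trans (⊙-⊕ˡ I (p ⋆ Y₁) (⊝ N)) (⊕-cong (I-⊙ (⊝ N)) (⊙-⋆ˡ p Y₁ (⊝ N)))))
    exact-expansion : h ⊙ ((γ ⊙ Q) ⊙ γ') ≋ (I ⊕ p ⋆ Y₁) ⊕ p ⋆ (⊝ N ⊕ p ⋆ Y₂)
    exact-expansion = ≋-trans (⊙-cong (≋-refl {A = h}) γQγ'≋)
      (≋-trans (≋-trans (⊙-⊕ʳ h X₀ (p ⋆ (X₀ ⊙ ⊝ N))) (⊕-cong (≋-refl {A = h ⊙ X₀}) (⊙-⋆ʳ p h (X₀ ⊙ ⊝ N))))
               (⊕-cong hX₀≋ (⋆-cong p hX₀N≋)))
    WNW' : Matrix n
    WNW' = W ⊙ (N ⊙ W')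
    Y₁≡WNW' : Y₁ ≡ₘ WNW' mod 1
    Y₁≡WNW' = ≡ₘ-⊙ h≡W (≡ₘ-⊙ (≡ₘ-refl {A = N}) Q≡W')
    drop-higher-terms : ((I ⊕ p ⋆ Y₁) ⊕ p ⋆ (⊝ N ⊕ p ⋆ Y₂)) ≡ₘ (I ⊕ p ⋆ (WNW' ⊕ ⊝ N)) mod (suc M)
    drop-higher-terms i j = ∣-cong (solve 6 (λ e p y₁ w nn y₂ → p :* (y₁ :- w) :+ (p :* p) :* y₂ :=
                   ((e :+ p :* y₁) :+ p :* ((:- nn) :+ p :* y₂)) :- (e :+ p :* (w :+ (:- nn)))) refl
                   (I i j) p (Y₁ i j) (WNW' i j) (N i j) (Y₂ i j))
      (∣-+ (P.subst (λ t → π^ t ∣ (p * (Y₁ i j - WNW' i j))) (ℕP.+-comm M 1) (∣-* (π^-∣-π^ M) (Y₁≡WNW' i j)))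
           (∣-*ʳ (Y₂ i j) (∣-*-square 1≤M (π^-∣-π^ M) (π^-∣-π^ M))))

  -- For W ∈ SL_n(R) with left inverse W', the difference W N W' - N with
  -- N = b E_ij (i ≠ j) has a lift: take h ∈ H lifting W and the commutator
  -- h γ h⁻¹ γ⁻¹ with γ = I + π^M N, which lies in H by normality.
  HasLift-conjugation : ∀ M → 1 ℕ.≤ M → (W W' : Matrix n) → Det W ≈ 1# → W' ⊙ W ≋ I →
    ∀ (i j : Fin n) → ¬ i P.≡ j → ∀ b → HasLift M ((W ⊙ ((b ⋆ E i j) ⊙ W')) ⊕ ⊝ (b ⋆ E i j))
  HasLift-conjugation M 1≤M W W' DetW≈1 W'W≋I i j i≢j b with lift-mod-π W DetW≈1
  ... | h , h∈H , W≡h =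
    h ⊙ ((γ ⊙ Q) ⊙ γ') , mulCl h _ h∈H conjugate∈H ,
    ≡ₘ-sym (commutator-expansion M h Q W W' N γ γ' 1≤M hQ≋I (≡ₘ-sym W≡h) Q≡W' γ≋ γ'≋)
    where
    h⁻¹ : Inverse h
    h⁻¹ = SL-inverse h (inSL h h∈H)
    Q : Matrix n
    Q = Inverse.inv h⁻¹
    hQ≋I : h ⊙ Q ≋ I
    hQ≋I = Inverse.right-inv h⁻¹
    -- Q = W' W Q ≡ W' h Q = W' modulo π
    Q≡W' : Q ≡ₘ W' mod 1
    Q≡W' = ≡ₘ-trans (≡ₘ-reflexive (≋-trans (≋-sym (I-⊙ Q)) (≋-trans (⊙-cong (≋-sym W'W≋I) (≋-refl {A = Q})) (⊙-assoc W' W Q))))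
          (≡ₘ-trans (≡ₘ-⊙ (≡ₘ-refl {A = W'}) (≡ₘ-⊙ W≡h (≡ₘ-refl {A = Q})))
             (≡ₘ-reflexive (≋-trans (⊙-cong (≋-refl {A = W'}) hQ≋I) (⊙-I W'))))
    N : Matrix n
    N = b ⋆ E i j
    t : Carrier
    t = π^[ M ] * b
    j≢i : ¬ j P.≡ i
    j≢i eq = i≢j (P.sym eq)
    -- γ = I + t E_ij is column j += t · column i of I, and γ' its inverse
    γ γ' : Matrix n
    γ  = addCol j i t I
    γ' = addCol j i (- t) I
    γγ'≋I : γ ⊙ γ' ≋ I
    γγ'≋I = ≋-trans (≋-sym (addCol-⊙ j i (- t) γ I)) (≋-trans (addCol-cong j i (- t) (⊙-I γ)) (addCol-undo j i t j≢i I))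
    conjugate∈H : H ((γ ⊙ Q) ⊙ γ')
    conjugate∈H = normal γ γ' Q (Det-addCol-I j i t j≢i) γγ'≋I (invCl h Q h∈H hQ≋I)
    γ≋ : γ ≋ I ⊕ π^[ M ] ⋆ N
    γ≋ r s = trans (addCol-formula j i t I r s) (+-congˡ
      (solve 5 (λ js p b ri rs → js :* ((p :* b) :* ri) := p :* (b :* (ri :* js))) refl (I j s) π^[ M ] b (I r i) (I r s)))
    γ'≋ : γ' ≋ I ⊕ π^[ M ] ⋆ ⊝ N
    γ'≋ r s = trans (addCol-formula j i (- t) I r s) (+-congˡ
      (solve 5 (λ js p b ri rs → js :* ((:- (p :* b)) :* ri) := p :* (:- (b :* (ri :* js)))) refl (I j s) π^[ M ] b (I r i) (I r s)))

  -- Every b E_ij (i ≠ j) has a lift: conjugating by W = diag(u at i, u⁻¹ at j)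
  -- multiplies E_ij by u², so W (b E_ij) W⁻¹ - b E_ij = (u² - 1) b E_ij,
  -- and u² - 1 is a unit.
  HasLift-elementary : ∀ M → 1 ℕ.≤ M → ∀ (i j : Fin n) → ¬ i P.≡ j → ∀ a → HasLift M (a ⋆ E i j)
  HasLift-elementary M 1≤M i j i≢j a = HasLift-≋ difference≋ (HasLift-conjugation M 1≤M W W' DetW≈1 W'W≋I i j i≢j b)
    where
    good : Σ Carrier λ u → Unit u × Unit (u * u - 1#)
    good = unit-with-unit-square-minus-one 4≤q
    u v w : Carrier
    u = proj₁ good
    v = proj₁ (proj₁ (proj₂ good))
    w = proj₁ (proj₂ (proj₂ good))
    uv≈1 : u * v ≈ 1#
    uv≈1 = proj₂ (proj₁ (proj₂ good))
    [u²-1]w≈1 : (u * u - 1#) * w ≈ 1#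
    [u²-1]w≈1 = proj₂ (proj₂ (proj₂ good))
    d d' : Fin n → Carrier
    d  r = scaleAt i u r * scaleAt j v r
    d' r = scaleAt i v r * scaleAt j u r
    W W' : Matrix n
    W  = diagonal d
    W' = diagonal d'
    b : Carrier
    b = a * w
    W'W≋I : W' ⊙ W ≋ I
    W'W≋I = diagonal-inverse d d' (λ r → trans (interchange-* (scaleAt i v r) (scaleAt j u r) (scaleAt i u r) (scaleAt j v r))
      (trans (*-cong (scaleAt-inverse i (trans (*-comm v u) uv≈1) r) (scaleAt-inverse j uv≈1 r)) (*-identityˡ 1#)))
    DetW≈1 : Det W ≈ 1#
    DetW≈1 = begin
      Det W                                    ≈⟨ Det-diagonal-matrix d ⟩
      ∏ d                                      ≈⟨ ∏-* (scaleAt i u) (scaleAt j v) ⟩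
      ∏ (scaleAt i u) * ∏ (scaleAt j v)        ≈⟨ *-cong (∏-scaleAt i u) (∏-scaleAt j v) ⟩
      u * v                                    ≈⟨ uv≈1 ⟩
      1# ∎
    W-column-i : ∀ r → I r i * d r ≈ I r i * u
    W-column-i r with r F.≟ i
    ... | yes P.refl = *-congˡ (trans (*-congˡ (scaleAt-off j v r i≢j)) (*-identityʳ u))
    ... | no r≢i     = trans (*-congʳ (I-off r i r≢i)) (trans (zeroˡ _) (sym (trans (*-congʳ (I-off r i r≢i)) (zeroˡ _))))
    d'j≈u : d' j ≈ u
    d'j≈u = trans (*-cong (scaleAt-off i v j (λ eq → i≢j (P.sym eq))) (scaleAt-at j u)) (*-identityˡ u)
    difference≋ : (W ⊙ ((b ⋆ E i j) ⊙ W')) ⊕ ⊝ (b ⋆ E i j) ≋ a ⋆ E i j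
    difference≋ r s = begin
      (W ⊙ ((b ⋆ E i j) ⊙ W')) r s - b * (I r i * I j s)  ≈⟨ +-congʳ (⊙-E-⊙ W W' i j b r s) ⟩
      (I r i * d r) * b * (I j s * d' j) - b * (I r i * I j s)
        ≈⟨ +-congʳ (*-cong (*-congʳ (W-column-i r)) (*-congˡ d'j≈u)) ⟩
      (I r i * u) * b * (I j s * u) - b * (I r i * I j s)
        ≈⟨ solve 5 (λ x u a w y → (x :* u) :* (a :* w) :* (y :* u) :- (a :* w) :* (x :* y) := ((u :* u :- K1) :* w) :* (a :* (x :* y)))
             refl (I r i) u a w (I j s) ⟩
      ((u * u - 1#) * w) * (a * (I r i * I j s))          ≈⟨ trans (*-congʳ [u²-1]w≈1) (*-identityˡ _) ⟩
      a * (I r i * I j s) ∎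

  -- Every a (E_jj - E_ii) (i ≠ j) has a lift: conjugating a E_ij by
  -- W = I + E_ji gives a (E_ij + E_jj - E_ii - E_ji), so the difference is
  -- a (E_jj - E_ii - E_ji); add a lift of a E_ji.
  HasLift-diagonal : ∀ M → 1 ℕ.≤ M → ∀ (i j : Fin n) → ¬ i P.≡ j → ∀ a → HasLift M (a ⋆ (E j j ⊕ ⊝ (E i i)))
  HasLift-diagonal M 1≤M i j i≢j a =
    HasLift-≋ add-back (HasLift-⊕ 1≤M (HasLift-≋ difference≋ (HasLift-conjugation M 1≤M W W' DetW≈1 W'W≋I i j i≢j a))
                                      (HasLift-elementary M 1≤M j i (λ eq → i≢j (P.sym eq)) a))
    where
    W W' : Matrix n
    W  = addCol i j 1# I
    W' = addCol i j (- 1#) I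
    DetW≈1 : Det W ≈ 1#
    DetW≈1 = Det-addCol-I i j 1# i≢j
    W'W≋I : W' ⊙ W ≋ I
    W'W≋I = ≋-trans (≋-sym (addCol-⊙ i j 1# W' I)) (≋-trans (addCol-cong i j 1# (⊙-I W'))
              (≋-trans (addCol-coef i j W' (solve 1 (λ x → x := :- (:- x)) refl 1#)) (addCol-undo i j (- 1#) i≢j I)))
    T : Matrix n
    T = a ⋆ ((E j j ⊕ ⊝ (E i i)) ⊕ ⊝ (E j i))
    difference≋ : (W ⊙ ((a ⋆ E i j) ⊙ W')) ⊕ ⊝ (a ⋆ E i j) ≋ T
    difference≋ r s = begin
      (W ⊙ ((a ⋆ E i j) ⊙ W')) r s - a * (I r i * I j s)     ≈⟨ +-congʳ (⊙-E-⊙ W W' i j a r s) ⟩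
      W r i * a * W' j s - a * (I r i * I j s)
        ≈⟨ +-congʳ (*-cong (*-congʳ (addCol-formula i j 1# I r i)) (addCol-formula i j (- 1#) I j s)) ⟩
      (I r i + I i i * (1# * I r j)) * a * (I j s + I i s * (- 1# * I j j)) - a * (I r i * I j s)
        ≈⟨ +-congʳ (*-cong (*-congʳ (+-congˡ (*-congʳ (I-diag i)))) (+-congˡ (*-congˡ (*-congˡ (I-diag j))))) ⟩
      (I r i + 1# * (1# * I r j)) * a * (I j s + I i s * (- 1# * 1#)) - a * (I r i * I j s)
        ≈⟨ solve 5 (λ x y z t a → (x :+ K1 :* (K1 :* y)) :* a :* (z :+ t :* ((:- K1) :* K1)) :- a :* (x :* z) :=
                                a :* ((y :* z :+ (:- (x :* t))) :+ (:- (y :* t)))) refl (I r i) (I r j) (I j s) (I i s) a ⟩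
      T r s ∎
    add-back : T ⊕ a ⋆ E j i ≋ a ⋆ (E j j ⊕ ⊝ (E i i))
    add-back r s = solve 4 (λ a x y z → a :* ((x :+ (:- y)) :+ (:- z)) :+ a :* z := a :* (x :+ (:- y))) refl a (E j j r s) (E i i r s) (E j i r s)

  -- Fix a base index z.  The matrices F_ij = E_ij - δ_ij E_zz have trace 0
  -- and, together with E_zz, span all matrices.
  module _ (z : Fin n) where

    F : Fin n → Fin n → Matrix n
    F i j = E i j ⊕ ⊝ (I i j ⋆ E z z)

    HasLift-F : ∀ M → 1 ℕ.≤ M → ∀ i j a → HasLift M (a ⋆ F i j)
    HasLift-F M 1≤M i j a with i F.≟ j
    ... | no i≢j = HasLift-≋ (λ r s → *-congˡ (sym (trans (+-congˡ (trans (-‿cong (trans (*-congʳ (I-off i j i≢j)) (zeroˡ _))) -0≈0))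
                                                        (+-identityʳ _))))
                             (HasLift-elementary M 1≤M i j i≢j a)
    ... | yes P.refl with z F.≟ i
    ...   | yes P.refl = HasLift-≋ (λ r s → sym (trans (*-congˡ (trans (+-congˡ (-‿cong (trans (*-congʳ (I-diag z)) (*-identityˡ _))))
                                                                      (-‿inverseʳ _))) (zeroʳ a)))
                                   (HasLift-O M)
    ...   | no z≢i     = HasLift-≋ (λ r s → *-congˡ (+-congˡ (-‿cong (sym (trans (*-congʳ (I-diag i)) (*-identityˡ _))))))
                                   (HasLift-diagonal M 1≤M z i z≢i a)

    decomposition : ∀ (X : Matrix n) r s → ∑ (λ i → ∑ (λ j → (X i j ⋆ F i j) r s)) + tr X * E z z r s ≈ X r s
    decomposition X r s = begin
      ∑ (λ i → ∑ (λ j → X i j * (I r i * I j s + - (I i j * e)))) + tr X * e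
        ≈⟨ +-congʳ (∑-cong {n} row) ⟩
      ∑ (λ i → I r i * X i s + - (X i i * e)) + tr X * e
        ≈⟨ +-congʳ (∑-+ {n} (λ i → I r i * X i s) (λ i → - (X i i * e))) ⟩
      (∑ (λ i → I r i * X i s) + ∑ (λ i → - (X i i * e))) + tr X * e
        ≈⟨ +-congʳ (+-cong (I-⊙ X r s) (trans (∑-neg {n} (λ i → X i i * e)) (-‿cong (sym (∑-*ʳ {n} e (λ i → X i i)))))) ⟩
      (X r s + - (tr X * e)) + tr X * e
        ≈⟨ solve 2 (λ x y → (x :+ (:- y)) :+ y := x) refl (X r s) (tr X * e) ⟩
      X r s ∎
      where
      e : Carrier
      e = E z z r s
      row : ∀ i → ∑ (λ j → X i j * (I r i * I j s + - (I i j * e))) ≈ I r i * X i s + - (X i i * e)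
      row i = begin
        ∑ (λ j → X i j * (I r i * I j s + - (I i j * e)))
          ≈⟨ ∑-cong {n} (λ j → solve 5 (λ x a b d c → x :* (a :* b :+ (:- (d :* c))) := a :* (x :* b) :+ (:- ((x :* d) :* c)))
                                 refl (X i j) (I r i) (I j s) (I i j) e) ⟩
        ∑ (λ j → I r i * (X i j * I j s) + - ((X i j * I i j) * e))
          ≈⟨ ∑-+ {n} (λ j → I r i * (X i j * I j s)) (λ j → - ((X i j * I i j) * e)) ⟩
        ∑ (λ j → I r i * (X i j * I j s)) + ∑ (λ j → - ((X i j * I i j) * e))
          ≈⟨ +-cong (sym (∑-*ˡ {n} (I r i) (λ j → X i j * I j s)))
                    (trans (∑-neg {n} (λ j → (X i j * I i j) * e)) (-‿cong (sym (∑-*ʳ {n} e (λ j → X i j * I i j))))) ⟩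
        I r i * ∑ (λ j → X i j * I j s) + - (∑ (λ j → X i j * I i j) * e)
          ≈⟨ +-cong (*-congˡ (⊙-I X i s)) (-‿cong (*-congʳ (trans (∑-cong {n} (λ j → *-congˡ (I-symmetric i j))) (⊙-I X i i)))) ⟩
        I r i * X i s + - (X i i * e) ∎

    -- every X with π ∣ tr X has a lift: the E_zz component vanishes mod π
    HasLift-traceless : ∀ M → 1 ℕ.≤ M → (X : Matrix n) → π^ 1 ∣ tr X → HasLift M X
    HasLift-traceless M 1≤M X π∣trX = HasLift-≋ (decomposition X) (HasLift-⊕ 1≤M F-part E-part)
      where
      F-part : HasLift M (λ r s → ∑ (λ i → ∑ (λ j → (X i j ⋆ F i j) r s)))
      F-part = HasLift-∑ 1≤M (λ i r s → ∑ (λ j → (X i j ⋆ F i j) r s))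
                 (λ i → HasLift-∑ 1≤M (λ j → X i j ⋆ F i j) (λ j → HasLift-F M 1≤M i j (X i j)))
      E-part : HasLift M (tr X ⋆ E z z)
      E-part = HasLift-mod-π (λ r s → ≡-sym (∣⇒≡-zero (∣-*ʳ (E z z r s) π∣trX))) (HasLift-O M)

    -- Writing B = I + π^M X, the
    -- determinant condition gives π^M tr X ≡ 0 mod π^(M+1); as R is a
    -- domain, either π^M = 0 (and B = I) or π ∣ tr X.
    next-layer : ∀ M → 1 ℕ.≤ M → ∀ B → Det B ≈ 1# → B ≡ₘ I mod M → Σ (Matrix n) λ G → H G × B ≡ₘ G mod (suc M)
    next-layer M 1≤M B DetB≈1 B≡I = by-cases (IsDVR.noZeroDiv dvr p (tr X - k * π) p[trX-kπ]≈0)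
      where
      p : Carrier
      p = π^[ M ]
      X : Matrix n
      X r s = π^_∣_.quotient (B≡I r s)
      B≋ : ∀ r s → B r s ≈ I r s + p * X r s
      B≋ r s = begin
        B r s                    ≈⟨ solve 2 (λ b e → b := e :+ (b :- e)) refl (B r s) (I r s) ⟩
        I r s + (B r s - I r s)  ≈⟨ +-congˡ (sym (π^_∣_.proof (B≡I r s))) ⟩
        I r s + X r s * p        ≈⟨ +-congˡ (*-comm _ _) ⟩
        I r s + p * X r s ∎
      πᴹ⁺¹∣πᴹtrX : π^ (suc M) ∣ (p * tr X)
      πᴹ⁺¹∣πᴹtrX = ∣-cong (trans (-‿cong (+-congʳ DetB≈1)) (solve 2 (λ p t → :- (K1 :- (K1 :+ p :* t)) := p :* t) refl p (tr X)))
                          (∣-neg (Det-near-I M X B 1≤M B≋))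
      k : Carrier
      k = π^_∣_.quotient πᴹ⁺¹∣πᴹtrX
      p[trX-kπ]≈0 : p * (tr X - k * π) ≈ 0#
      p[trX-kπ]≈0 = begin
        p * (tr X - k * π)      ≈⟨ solve 4 (λ p t k π → p :* (t :- k :* π) := p :* t :- k :* (π :* p)) refl p (tr X) k π ⟩
        p * tr X - k * (π * p)  ≈⟨ +-congˡ (-‿cong (π^_∣_.proof πᴹ⁺¹∣πᴹtrX)) ⟩
        p * tr X - p * tr X     ≈⟨ -‿inverseʳ _ ⟩
        0# ∎
      by-cases : (p ≈ 0#) ⊎ (tr X - k * π ≈ 0#) → Σ (Matrix n) λ G → H G × B ≡ₘ G mod (suc M)
      by-cases (inj₁ p≈0) = I , hasId , (λ r s → ∣-cong (sym (B-I≈0 r s)) (∣-zero (suc M)))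
        where
        B-I≈0 : ∀ r s → B r s - I r s ≈ 0#
        B-I≈0 r s = begin
          B r s - I r s                ≈⟨ +-congʳ (B≋ r s) ⟩
          (I r s + p * X r s) - I r s  ≈⟨ +-congʳ (+-congˡ (trans (*-congʳ p≈0) (zeroˡ _))) ⟩
          (I r s + 0#) - I r s         ≈⟨ solve 1 (λ e → (e :+ K0) :- e := K0) refl (I r s) ⟩
          0# ∎
      by-cases (inj₂ trX≈kπ) = G , G∈H , ≡ₘ-trans (≡ₘ-reflexive B≋) B≡G
        where
        π∣trX : π^ 1 ∣ tr X
        π∣trX = k , (begin
          k * (π * 1#)             ≈⟨ *-congˡ (*-identityʳ π) ⟩
          k * π                    ≈⟨ solve 2 (λ t kp → kp := t :- (t :- kp)) refl (tr X) (k * π) ⟩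
          tr X - (tr X - k * π)    ≈⟨ +-congˡ (-‿cong trX≈kπ) ⟩
          tr X - 0#                ≈⟨ trans (+-congˡ -0≈0) (+-identityʳ _) ⟩
          tr X ∎)
        lift : HasLift M X
        lift = HasLift-traceless M 1≤M X π∣trX
        G : Matrix n
        G = proj₁ lift
        G∈H : H G
        G∈H = proj₁ (proj₂ lift)
        B≡G : (I ⊕ p ⋆ X) ≡ₘ G mod (suc M)
        B≡G = proj₂ (proj₂ lift)

    approximate-from-layer : ∀ d M → 1 ℕ.≤ M → ∀ B → Det B ≈ 1# → B ≡ₘ I mod M →
      Σ (Matrix n) λ C → H C × B ≡ₘ C mod (M ℕ.+ d)
    approximate-from-layer zero M 1≤M B DetB≈1 B≡I =
      I , hasId , P.subst (λ t → B ≡ₘ I mod t) (P.sym (ℕP.+-identityʳ M)) B≡I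
    approximate-from-layer (suc d) M 1≤M B DetB≈1 B≡I =
      C' ⊙ G , mulCl C' G C'∈H G∈H , P.subst (λ t → B ≡ₘ (C' ⊙ G) mod t) (P.sym (ℕP.+-suc M d)) B≡C'G
      where
      layer : Σ (Matrix n) λ G → H G × B ≡ₘ G mod (suc M)
      layer = next-layer M 1≤M B DetB≈1 B≡I
      G : Matrix n
      G = proj₁ layer
      G∈H : H G
      G∈H = proj₁ (proj₂ layer)
      B≡G : B ≡ₘ G mod (suc M)
      B≡G = proj₂ (proj₂ layer)
      G⁻¹ : Inverse G
      G⁻¹ = SL-inverse G (inSL G G∈H)
      -- the remaining error B G⁻¹ lies one layer deeper
      B' : Matrix n
      B' = B ⊙ Inverse.inv G⁻¹
      B'≡I : B' ≡ₘ I mod (suc M)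
      B'≡I = ≡ₘ-trans (≡ₘ-⊙ B≡G (≡ₘ-refl {A = Inverse.inv G⁻¹})) (≡ₘ-reflexive (Inverse.right-inv G⁻¹))
      deeper : Σ (Matrix n) λ C → H C × B' ≡ₘ C mod (suc M ℕ.+ d)
      deeper = approximate-from-layer d (suc M) (ℕP.≤-trans 1≤M (ℕP.n≤1+n M)) B'
                 (trans (Inverse.Det-⊙inv G⁻¹ B) DetB≈1) B'≡I
      C' : Matrix n
      C' = proj₁ deeper
      C'∈H : H C'
      C'∈H = proj₁ (proj₂ deeper)
      B≡C'G : B ≡ₘ (C' ⊙ G) mod (suc M ℕ.+ d)
      B≡C'G = ≡ₘ-trans (≡ₘ-reflexive (≋-trans (≋-sym (⊙-I B)) (≋-trans (⊙-cong (≋-refl {A = B}) (≋-sym (Inverse.left-inv G⁻¹)))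
                                      (≋-sym (⊙-assoc B (Inverse.inv G⁻¹) G)))))
                       (≡ₘ-⊙ (proj₂ (proj₂ deeper)) (≡ₘ-refl {A = G}))

    -- every A ∈ SL_n(R) is congruent modulo every π^K to an element of H:
    -- lift A mod π by surjectivity, then approximate the correction A h⁻¹,
    -- which is ≡ I mod π
    approximate : ∀ A → Det A ≈ 1# → ∀ K → Σ (Matrix n) λ C → H C × A ≡ₘ C mod K
    approximate A DetA≈1 zero    = I , hasId , (λ r s → (A r s - I r s) , *-identityʳ _)
    approximate A DetA≈1 (suc K) = C ⊙ h , mulCl C h C∈H h∈H , A≡Ch
      where
      lift : Σ (Matrix n) λ h → H h × A ≡ₘ h mod 1
      lift = lift-mod-π A DetA≈1
      h : Matrix n
      h = proj₁ lift
      h∈H : H h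
      h∈H = proj₁ (proj₂ lift)
      A≡h : A ≡ₘ h mod 1
      A≡h = proj₂ (proj₂ lift)
      h⁻¹ : Inverse h
      h⁻¹ = SL-inverse h (inSL h h∈H)
      B : Matrix n
      B = A ⊙ Inverse.inv h⁻¹
      B≡I : B ≡ₘ I mod 1
      B≡I = ≡ₘ-trans (≡ₘ-⊙ A≡h (≡ₘ-refl {A = Inverse.inv h⁻¹})) (≡ₘ-reflexive (Inverse.right-inv h⁻¹))
      approx : Σ (Matrix n) λ C → H C × B ≡ₘ C mod (1 ℕ.+ K)
      approx = approximate-from-layer K 1 (ℕ.s≤s ℕ.z≤n) B (trans (Inverse.Det-⊙inv h⁻¹ A) DetA≈1) B≡I
      C : Matrix n
      C = proj₁ approx
      C∈H : H C
      C∈H = proj₁ (proj₂ approx)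
      A≡Ch : A ≡ₘ (C ⊙ h) mod (suc K)
      A≡Ch = ≡ₘ-trans (≡ₘ-reflexive (≋-trans (≋-sym (⊙-I A)) (≋-trans (⊙-cong (≋-refl {A = A}) (≋-sym (Inverse.left-inv h⁻¹)))
                                     (≋-sym (⊙-assoc A (Inverse.inv h⁻¹) h)))))
                      (≡ₘ-⊙ (proj₂ (proj₂ approx)) (≡ₘ-refl {A = h}))

-- Proposition 3.8.  By `approximate`, every A ∈ SL_n(R) is a limit of
-- elements of H; as H is closed, A ∈ H.
proposition3p8 : ∀ {c ℓ ℓ'} (R : CommutativeRing c ℓ) (π : CommutativeRing.Carrier R)
    → IsDVR R π → IsComplete R π → EqualChar R
    → (q : ℕ) → ResidueFieldCard R π q → 10 ≤ q
    → (n : ℕ) → 2 ≤ n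
    → (H : Mat R n → Set ℓ')
    → IsSubgroupSL R n H → IsNormalSL R n H → IsClosed R n π H
    → SurjectsResidue R n π H
    → ∀ A → InSL R A → H A
proposition3p8 R π dvr _ _ q res 10≤q zero () H subgroup normal closed surjective A A∈SL
proposition3p8 R π dvr _ _ q res 10≤q (suc n) _ H subgroup normal closed surjective A A∈SL =
  closed A (λ m → let (C , C∈H , A≡C) = approximations m in C , C∈H , (λ i j → Adic.toDivides R π (A≡C i j)))
  where
  4≤q : 4 ℕ.≤ q
  4≤q = ℕP.≤-trans (ℕP.+-monoʳ-≤ 4 ℕ.z≤n) 10≤q
  approximations : ∀ K → Σ (Mat R (suc n)) λ C → H C × Adic._≡ₘ_mod_ R π A C K
  approximations = Lifting.approximate R π dvr q res 4≤q (suc n) H subgroup normal surjective zero A A∈SL
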